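{- For $n\in\mathbb N$ and $\vec a=(g,v,a,b,c,d,e)\in\mathbb N^7$, define $$\begin{aligned} S(n,\vec a)={}&(c-12^{3g+2})^2+(d-ag)^2+(e-bg)^2+(2^n-2^{g+v})^2\\ &+(2^c-2^{3d+2a})^2+(2^{c+1}-2^{6e+5b})^2 . \end{aligned}$$ Let $t(n)=12^{3n+3}$ and $w(n)=22\,t(n)+27$. For natural numbers $t,w\ge1$ define $$M(n,t,w)=\sum_{\vec a\in\{0,\dots,t-1\}^7} 2^{2w\beta_t(\vec a)}\,\delta\big(S(n,\vec a),w\big).$$ Here: - if $\vec a=(a_1,\dots,a_7)$, then $\beta_t(\vec a)=a_1+a_2t+a_3t^2+\cdots+a_7t^6$; - $\delta(x,w)=(2^w-1)(2^w-x+1)$. Then, for every $n\in\mathbb N$, the number of natural numbers $g$ with $0\le g\le n$ such that $6g+5$ is a Fermat prime equals $$\frac{\operatorname{HW}\big(M(n,t(n),w(n))\big)}{w(n)}-t(n)^7 .$$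
   Context: $\mathbb N=\{0,1,2,\dots\}$. Subtraction in $S$ and $\delta$ is ordinary integer subtraction. $\operatorname{HW}(N)$ denotes the Hamming weight of $N\in\mathbb N$, i.e. the number of ones in its binary representation. A Fermat prime is a prime of the form $2^{2^k}+1$ with $k\ge0$. -}

module Defs where

open import Data.Nat as ℕ using (ℕ; zero; suc; _+_; _*_; _^_; _<_; _≤_; z≤n; s≤s; _%_; _/_)
open import Data.Nat.Properties as ℕP using (≤-trans; ≤-refl; +-monoˡ-≤; m≤m+n; n≤1+n; <-≤-trans)
open import Data.Nat.Primality using (Prime; prime?)
open import Data.Integer as ℤ using (ℤ; +_; 0ℤ; 1ℤ)
open import Data.Fin using (Fin; toℕ; fromℕ<)
open import Data.Fin.Properties using (any?; toℕ-fromℕ<)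
open import Data.Product using (Σ; ∃; _×_; _,_; proj₁; proj₂)
open import Data.List using (List; length; filter; upTo)
open import Relation.Nullary using (Dec; yes; no; ¬_)
open import Relation.Nullary.Decidable using (_×-dec_)
open import Relation.Binary.PropositionalEquality using (_≡_; refl; subst; sym; cong)

IsFermatForm : ℕ → Set
IsFermatForm p = ∃ λ k → p ≡ 2 ^ (2 ^ k) + 1

IsFermatPrime : ℕ → Set
IsFermatPrime p = Prime p × IsFermatForm p

n<2^n : ∀ n → n < 2 ^ n
n<2^n zero = s≤s z≤n
n<2^n (suc n) = ≤-trans (s≤s (n<2^n n)) (+-monoʳ (2 ^ n) (1≤2^ n))
  where
  1≤2^ : ∀ m → 1 ≤ 2 ^ m
  1≤2^ zero = s≤s z≤n
  1≤2^ (suc m) = ≤-trans (1≤2^ m) (m≤m+n (2 ^ m) (2 ^ m + 0))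
  +-monoʳ : ∀ x → 1 ≤ x → suc x ≤ x + (x + 0)
  +-monoʳ x h rewrite ℕP.+-identityʳ x = ≤-trans (ℕP.+-comm 1 x ▸ ≤-refl) (ℕP.+-monoʳ-≤ x h)
    where
    _▸_ : ∀ {a b c} → a ≡ b → c ≤ a → c ≤ b
    eq ▸ le = subst (_ ≤_) eq le

-- if p = 2^(2^k)+1 then k < p, so the existential is bounded
fermat-bound : ∀ {p} k → p ≡ 2 ^ (2 ^ k) + 1 → k < p
fermat-bound {p} k eq = subst (k <_) (sym eq)
  (≤-trans (n<2^n k) (≤-trans (ℕP.<⇒≤ (n<2^n (2 ^ k))) (m≤m+n (2 ^ (2 ^ k)) 1)))

isFermatForm? : ∀ p → Dec (IsFermatForm p)
isFermatForm? p with any? {n = p} (λ (i : Fin p) → p ℕ.≟ 2 ^ (2 ^ toℕ i) + 1)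
... | yes (i , eq) = yes (toℕ i , eq)
... | no ¬e = no λ where
  (k , eq) → ¬e (fromℕ< (fermat-bound k eq) ,
                 subst (λ j → p ≡ 2 ^ (2 ^ j) + 1) (sym (toℕ-fromℕ< (fermat-bound k eq))) eq)

isFermatPrime? : ∀ p → Dec (IsFermatPrime p)
isFermatPrime? p = prime? p ×-dec isFermatForm? p

fermatCount : ℕ → ℕ
fermatCount n = length (filter (λ g → isFermatPrime? (6 * g + 5)) (upTo (suc n)))

-- Hamming weight (number of ones in binary); fuel n suffices since
-- halving n at least n times reaches 0.

hwAux : ℕ → ℕ → ℕ
hwAux zero    m = 0
hwAux (suc f) m = m % 2 + hwAux f (m / 2)

HW : ℕ → ℕ
HW n = hwAux n n

sq : ℤ → ℤ
sq x = x ℤ.* x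

S : ℕ → ℕ → ℕ → ℕ → ℕ → ℕ → ℕ → ℕ → ℤ
S n g v a b c d e =
    sq (+ c ℤ.- + (12 ^ (3 * g + 2)))
  ℤ.+ sq (+ d ℤ.- + (a * g))
  ℤ.+ sq (+ e ℤ.- + (b * g))
  ℤ.+ sq (+ (2 ^ n) ℤ.- + (2 ^ (g + v)))
  ℤ.+ sq (+ (2 ^ c) ℤ.- + (2 ^ (3 * d + 2 * a)))
  ℤ.+ sq (+ (2 ^ (c + 1)) ℤ.- + (2 ^ (6 * e + 5 * b)))

δ : ℤ → ℕ → ℤ
δ x w = (+ (2 ^ w) ℤ.- 1ℤ) ℤ.* ((+ (2 ^ w) ℤ.- x) ℤ.+ 1ℤ)

β : ℕ → ℕ → ℕ → ℕ → ℕ → ℕ → ℕ → ℕ → ℕ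
β t a₁ a₂ a₃ a₄ a₅ a₆ a₇ =
  a₁ + a₂ * t + a₃ * t ^ 2 + a₄ * t ^ 3 + a₅ * t ^ 4 + a₆ * t ^ 5 + a₇ * t ^ 6

sumℤ : ℕ → (ℕ → ℤ) → ℤ
sumℤ zero    f = 0ℤ
sumℤ (suc k) f = sumℤ k f ℤ.+ f k

M : ℕ → ℕ → ℕ → ℤ
M n t w =
  sumℤ t λ g → sumℤ t λ v → sumℤ t λ a → sumℤ t λ b →
  sumℤ t λ c → sumℤ t λ d → sumℤ t λ e →
    + (2 ^ (2 * w * β t g v a b c d e)) ℤ.* δ (S n g v a b c d e) w

tt : ℕ → ℕ
tt n = 12 ^ (3 * n + 3)

ww : ℕ → ℕ
ww n = 22 * tt n + 27

-- Read N = β_t(a₁,…,a₇) as a base-t number: then M is the base-2^(2w) number whose N-th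
-- digit is δ(S(n,a), w). On the box S ≤ 2^w, and such a digit has Hamming weight w when
-- S > 0 (its two base-2^w halves are bitwise complements) and 2w when S = 0, so
-- HW(M) = w · (t⁷ + number of zeros of S in the box). S vanishes exactly when
-- c = 12^(3g+2) = a(3g+2), c + 1 = b(6g+5), d = ag, e = bg and v = n − g, so the zeros
-- correspond to the g ≤ n with 3g+2 ∣ 12^(3g+2) and 6g+5 ∣ 12^(3g+2) + 1. This holds iff
-- 6g+5 is a Fermat prime: the first divisibility forces 3g+2 = 2^j, the second then makes
-- 2^(j+1) + 1 prime by a Proth–Pépin argument, and j + 1 must be a power of 2. Conversely
-- for p = 6g+5 = 2^(2^k) + 1 prime, 12^(3g+2) = 2^(p−1)·(−3)^((p−1)/2) ≡ −1 (mod p) by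
-- Fermat's little theorem and because −3 is a non-residue modulo primes p ≡ 5 (mod 6).

module Submission where

open import Data.Nat
open import Data.Nat.Properties
open import Data.Nat.DivMod hiding (_mod_)
open import Data.Nat.Divisibility using (_∣_; _∣?_; divides; ∣⇒≤; ∣-trans; ∣1⇒≡1; 0∣⇒≡0; ∣m+n∣m⇒∣n)
open import Data.Nat.Primality using (Prime; euclidsLemma; prime⇒nonTrivial; prime⇒irreducible; irreducible⇒prime; prime?; prime[2])
open import Data.Nat.Primality.Factorisation using (factorise)
open import Data.Nat.Combinatorics using (_C_; nCn≡1; nC1≡n; k>n⇒nCk≡0; nCk+nC[k+1]≡[n+1]C[k+1])
open import Data.Nat.ListAction using (product)
open import Data.Nat.Induction using (<-rec)
open import Data.Nat.Tactic.RingSolver using (solve-∀)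
open import Data.Nat.Solver using (module +-*-Solver)
open import Data.Integer as ℤ using (ℤ; -[1+_]; _⊖_; 0ℤ; 1ℤ)
import Data.Integer.Properties as ℤ
open import Data.Integer.Divisibility.Signed as ℤ∣ using () renaming (_∣_ to _∣ℤ_)
open import Data.Integer.Tactic.RingSolver using () renaming (solve-∀ to ℤsolve-∀)
open import Data.Fin using (Fin; zero; suc; toℕ; fromℕ)
open import Data.Fin.Properties using (toℕ-fromℕ)
open import Data.List using ([]; _∷_; [_]; _++_; _∷ʳ_; length; filter; upTo)
open import Data.List.Properties using (filter-++; length-++; upTo-∷ʳ; filter-≐)
open import Data.List.Relation.Unary.All using (_∷_)
open import Data.Product as Product using (∃; ∃-syntax; _×_; _,_; proj₁; proj₂)
open import Data.Sum as Sum using (_⊎_; inj₁; inj₂; [_,_]′)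
open import Data.Empty using (⊥-elim)
open import Algebra.Bundles using (CommutativeSemiring)
open import Algebra.Structures using (IsCommutativeMonoid)
open import Algebra.Structures.Biased using (IsCommutativeSemiringˡ)
open import Algebra.Definitions using (Associative; Commutative; LeftIdentity; LeftZero; _DistributesOverʳ_)
open import Function using (_∘_; id; flip; _⇔_; mk⇔; Equivalence)
open import Level using (0ℓ)
open import Relation.Nullary using (¬_; Dec; yes; no)
open import Relation.Nullary.Decidable using (from-yes; _×-dec_)
open import Relation.Binary.Bundles using (Setoid)
open import Relation.Binary.Definitions using (tri<; tri≈; tri>)
import Relation.Binary.Reasoning.Setoid
open import Relation.Binary.PropositionalEquality hiding ([_])
open import Relation.Unary using (Decidable)

open import Defs

m≤1+n⇒m/2≤n : ∀ {m n} → m ≤ suc n → m / 2 ≤ n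
m≤1+n⇒m/2≤n {zero}      _   = z≤n
m≤1+n⇒m/2≤n {m@(suc _)} m≤n = ≤-pred (<-≤-trans (m/n<m m 2 (s≤s (s≤s z≤n))) m≤n)

hwAux-fuel : ∀ {f f′ m} → m ≤ f → m ≤ f′ → hwAux f m ≡ hwAux f′ m
hwAux-fuel {zero}  {zero}   z≤n z≤n = refl
hwAux-fuel {zero}  {suc f′} z≤n _   = hwAux-fuel {zero} {f′} z≤n z≤n
hwAux-fuel {suc f} {zero}   _   z≤n = hwAux-fuel {f} {zero} z≤n z≤n
hwAux-fuel {suc f} {suc f′} {m} m≤f m≤f′ =
  cong (m % 2 +_) (hwAux-fuel (m≤1+n⇒m/2≤n m≤f) (m≤1+n⇒m/2≤n m≤f′))

HW-step : ∀ m → HW m ≡ m % 2 + HW (m / 2)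
HW-step zero    = refl
HW-step (suc m) = cong (suc m % 2 +_) (hwAux-fuel {m} (m≤1+n⇒m/2≤n ≤-refl) ≤-refl)

divMod-digit : ∀ {t} .{{_ : NonZero t}} i j → i < t → (i + j * t) % t ≡ i × (i + j * t) / t ≡ j
divMod-digit {t} i j i<t =
  trans ([m+kn]%n≡m%n i j t) (m<n⇒m%n≡m i<t) ,
  trans (+-distrib-/-∣ʳ i (divides j refl)) (cong₂ _+_ (m<n⇒m/n≡0 i<t) (m*n/n≡m j t))

HW-+-2^* : ∀ k a b → a < 2 ^ k → HW (a + 2 ^ k * b) ≡ HW a + HW b
HW-+-2^* zero    zero    b _ = cong HW (+-identityʳ b)
HW-+-2^* zero    (suc a) b (s≤s ())
HW-+-2^* (suc k) a    b a<2^k+1 = begin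
  HW x                             ≡⟨ HW-step x ⟩
  x % 2 + HW (x / 2)               ≡⟨ cong₂ (λ r q → r + HW q) low high ⟩
  a % 2 + HW (a / 2 + 2 ^ k * b)   ≡⟨ cong (a % 2 +_) (HW-+-2^* k (a / 2) b a/2<2^k) ⟩
  a % 2 + (HW (a / 2) + HW b)      ≡⟨ +-assoc (a % 2) _ _ ⟨
  a % 2 + HW (a / 2) + HW b        ≡⟨ cong (_+ HW b) (HW-step a) ⟨
  HW a + HW b                      ∎
  where
  open ≡-Reasoning
  x = a + 2 ^ suc k * b
  regroup : ∀ r q p b → r + q * 2 + 2 * p * b ≡ r + (q + p * b) * 2
  regroup = solve-∀
  x≡ : x ≡ a % 2 + (a / 2 + 2 ^ k * b) * 2
  x≡ = trans (cong (_+ 2 ^ suc k * b) (m≡m%n+[m/n]*n a 2)) (regroup (a % 2) (a / 2) (2 ^ k) b)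
  low : x % 2 ≡ a % 2
  low = trans (cong (_% 2) x≡) (proj₁ (divMod-digit (a % 2) (a / 2 + 2 ^ k * b) (m%n<n a 2)))
  high : x / 2 ≡ a / 2 + 2 ^ k * b
  high = trans (cong (_/ 2) x≡) (proj₂ (divMod-digit (a % 2) (a / 2 + 2 ^ k * b) (m%n<n a 2)))
  a/2<2^k : a / 2 < 2 ^ k
  a/2<2^k = m<n*o⇒m/o<n (subst (a <_) (*-comm 2 (2 ^ k)) a<2^k+1)

1+2q≢2p : ∀ q p → 1 + q * 2 ≢ p * 2
1+2q≢2p q p eq = 1≢0 (begin
  1                ≡⟨ [m+kn]%n≡m%n 1 q 2 ⟨
  (1 + q * 2) % 2  ≡⟨ cong (_% 2) eq ⟩
  (p * 2) % 2      ≡⟨ m*n%n≡0 p 2 ⟩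
  0                ∎)
  where
  open ≡-Reasoning
  1≢0 : 1 ≢ 0
  1≢0 ()

bits-complement : ∀ {r s} q p → r < 2 → s < 2 → r + s + 1 + q * 2 ≡ p * 2 → r + s ≡ 1 × q + 1 ≡ p
bits-complement {0} {0} q p _ _ eq = ⊥-elim (1+2q≢2p q p eq)
bits-complement {1} {1} q p _ _ eq = ⊥-elim (1+2q≢2p (suc q) p eq)
bits-complement {0} {1} q p _ _ eq = refl , trans (+-comm q 1) (*-cancelʳ-≡ (suc q) p 2 eq)
bits-complement {1} {0} q p _ _ eq = refl , trans (+-comm q 1) (*-cancelʳ-≡ (suc q) p 2 eq)
bits-complement {suc (suc _)} _ _ (s≤s (s≤s ())) _ _
bits-complement {_} {suc (suc _)} _ _ _ (s≤s (s≤s ())) _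

HW-complement : ∀ w u v → u + v + 1 ≡ 2 ^ w → HW u + HW v ≡ w
HW-complement zero zero    zero    _  = refl
HW-complement zero zero    (suc v) eq with () ← trans (+-comm 1 v) (suc-injective eq)
HW-complement zero (suc u) v       eq with () ← trans (+-comm 1 (u + v)) (suc-injective eq)
HW-complement (suc w) u v eq = begin
  HW u + HW v                                        ≡⟨ cong₂ _+_ (HW-step u) (HW-step v) ⟩
  (u % 2 + HW (u / 2)) + (v % 2 + HW (v / 2))        ≡⟨ interchange (u % 2) (HW (u / 2)) (v % 2) (HW (v / 2)) ⟩
  (u % 2 + v % 2) + (HW (u / 2) + HW (v / 2))        ≡⟨ cong₂ _+_ low (HW-complement w (u / 2) (v / 2) high) ⟩
  suc w                                              ∎
  where
  open ≡-Reasoning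
  interchange : ∀ a b c d → (a + b) + (c + d) ≡ (a + c) + (b + d)
  interchange = solve-∀
  regroup : ∀ r s q p → (r + q * 2) + (s + p * 2) + 1 ≡ r + s + 1 + (q + p) * 2
  regroup = solve-∀
  digits : u % 2 + v % 2 + 1 + (u / 2 + v / 2) * 2 ≡ 2 ^ w * 2
  digits = begin
    u % 2 + v % 2 + 1 + (u / 2 + v / 2) * 2            ≡⟨ regroup (u % 2) (v % 2) (u / 2) (v / 2) ⟨
    (u % 2 + u / 2 * 2) + (v % 2 + v / 2 * 2) + 1      ≡⟨ cong₂ (λ x y → x + y + 1) (m≡m%n+[m/n]*n u 2) (m≡m%n+[m/n]*n v 2) ⟨
    u + v + 1                                          ≡⟨ eq ⟩
    2 * 2 ^ w                                          ≡⟨ *-comm 2 (2 ^ w) ⟩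
    2 ^ w * 2                                          ∎
  low : u % 2 + v % 2 ≡ 1
  low = proj₁ (bits-complement (u / 2 + v / 2) (2 ^ w) (m%n<n u 2) (m%n<n v 2) digits)
  high : u / 2 + v / 2 + 1 ≡ 2 ^ w
  high = proj₂ (bits-complement (u / 2 + v / 2) (2 ^ w) (m%n<n u 2) (m%n<n v 2) digits)

sumℕ : ℕ → (ℕ → ℕ) → ℕ
sumℕ zero    f = 0
sumℕ (suc k) f = sumℕ k f + f k

sumℕ-cong : ∀ k {f g} → (∀ i → i < k → f i ≡ g i) → sumℕ k f ≡ sumℕ k g
sumℕ-cong zero    _   = refl
sumℕ-cong (suc k) f≡g = cong₂ _+_ (sumℕ-cong k (λ i i<k → f≡g i (m<n⇒m<1+n i<k))) (f≡g k ≤-refl)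

sumℕ-const : ∀ k c → sumℕ k (λ _ → c) ≡ c * k
sumℕ-const zero    c = sym (*-zeroʳ c)
sumℕ-const (suc k) c = trans (cong (_+ c) (sumℕ-const k c)) (trans (+-comm (c * k) c) (sym (*-suc c k)))

sumℕ-zero : ∀ k {f} → (∀ i → i < k → f i ≡ 0) → sumℕ k f ≡ 0
sumℕ-zero k f≡0 = trans (sumℕ-cong k f≡0) (sumℕ-const k 0)

sumℕ-point : ∀ k {f} x → x < k → (∀ i → i < k → i ≢ x → f i ≡ 0) → sumℕ k f ≡ f x
sumℕ-point (suc k) {f} x x<1+k off with k ≟ x
... | yes refl = cong (_+ f k) (sumℕ-zero k (λ i i<k → off i (m<n⇒m<1+n i<k) (<⇒≢ i<k)))
... | no  k≢x  = begin
  sumℕ k f + f k  ≡⟨ cong₂ _+_ (sumℕ-point k x x<k (λ i i<k → off i (m<n⇒m<1+n i<k))) (off k ≤-refl k≢x) ⟩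
  f x + 0         ≡⟨ +-identityʳ (f x) ⟩
  f x             ∎
  where
  open ≡-Reasoning
  x<k : x < k
  x<k = ≤∧≢⇒< (≤-pred x<1+k) (k≢x ∘ sym)

sumℕ-+ : ∀ k f g → sumℕ k (λ i → f i + g i) ≡ sumℕ k f + sumℕ k g
sumℕ-+ zero    f g = refl
sumℕ-+ (suc k) f g = trans (cong (_+ (f k + g k)) (sumℕ-+ k f g)) (interchange (sumℕ k f) (sumℕ k g) (f k) (g k))
  where
  interchange : ∀ a b c d → (a + b) + (c + d) ≡ (a + c) + (b + d)
  interchange = solve-∀

sumℕ-*ˡ : ∀ k c f → sumℕ k (λ i → c * f i) ≡ c * sumℕ k f
sumℕ-*ˡ zero    c f = sym (*-zeroʳ c)
sumℕ-*ˡ (suc k) c f = trans (cong (_+ c * f k) (sumℕ-*ˡ k c f)) (sym (*-distribˡ-+ c (sumℕ k f) (f k)))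

sumℕ-swap : ∀ a b (F : ℕ → ℕ → ℕ) → sumℕ a (λ i → sumℕ b (F i)) ≡ sumℕ b (λ j → sumℕ a (λ i → F i j))
sumℕ-swap zero    b F = sym (sumℕ-const b 0)
sumℕ-swap (suc a) b F = begin
  sumℕ a (λ i → sumℕ b (F i)) + sumℕ b (F a)              ≡⟨ cong (_+ sumℕ b (F a)) (sumℕ-swap a b F) ⟩
  sumℕ b (λ j → sumℕ a (λ i → F i j)) + sumℕ b (F a)      ≡⟨ sumℕ-+ b (λ j → sumℕ a (λ i → F i j)) (F a) ⟨
  sumℕ b (λ j → sumℕ (suc a) (λ i → F i j))               ∎
  where open ≡-Reasoning

sumℕ-++ : ∀ m n f → sumℕ (m + n) f ≡ sumℕ m f + sumℕ n (λ i → f (m + i))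
sumℕ-++ m zero    f = trans (cong (λ k → sumℕ k f) (+-identityʳ m)) (sym (+-identityʳ _))
sumℕ-++ m (suc n) f = begin
  sumℕ (m + suc n) f                                  ≡⟨ cong (λ k → sumℕ k f) (+-suc m n) ⟩
  sumℕ (m + n) f + f (m + n)                          ≡⟨ cong (_+ f (m + n)) (sumℕ-++ m n f) ⟩
  sumℕ m f + sumℕ n (λ i → f (m + i)) + f (m + n)     ≡⟨ +-assoc (sumℕ m f) _ _ ⟩
  sumℕ m f + sumℕ (suc n) (λ i → f (m + i))           ∎
  where open ≡-Reasoning

sumℕ-pair : ∀ t T .{{_ : NonZero t}} (G : ℕ → ℕ → ℕ) →
            sumℕ t (λ i → sumℕ T (G i)) ≡ sumℕ (T * t) (λ N → G (N % t) (N / t))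
sumℕ-pair t T G = trans (sumℕ-swap t T G) (rows T)
  where
  H = λ N → G (N % t) (N / t)
  rows : ∀ T → sumℕ T (λ j → sumℕ t (λ i → G i j)) ≡ sumℕ (T * t) H
  rows zero    = refl
  rows (suc T) = begin
    sumℕ T (λ j → sumℕ t (λ i → G i j)) + sumℕ t (λ i → G i T)  ≡⟨ cong₂ _+_ (rows T) (sumℕ-cong t row) ⟩
    sumℕ (T * t) H + sumℕ t (λ i → H (T * t + i))               ≡⟨ sumℕ-++ (T * t) t H ⟨
    sumℕ (T * t + t) H                                          ≡⟨ cong (λ k → sumℕ k H) (+-comm (T * t) t) ⟩
    sumℕ (suc T * t) H                                          ∎
    where
    open ≡-Reasoning
    row : ∀ i → i < t → G i T ≡ H (T * t + i)
    row i i<t rewrite +-comm (T * t) i =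
      sym (cong₂ G (proj₁ (divMod-digit i T i<t)) (proj₂ (divMod-digit i T i<t)))

indicator : ∀ {A : Set} → Dec A → ℕ
indicator (yes _) = 1
indicator (no _)  = 0

indicator-yes : ∀ {A : Set} (a? : Dec A) → A → indicator a? ≡ 1
indicator-yes (yes _) _ = refl
indicator-yes (no ¬a) a = ⊥-elim (¬a a)

indicator-no : ∀ {A : Set} (a? : Dec A) → ¬ A → indicator a? ≡ 0
indicator-no (yes a) ¬a = ⊥-elim (¬a a)
indicator-no (no _)  _  = refl

HW-digits : ∀ L T (y : ℕ → ℕ) → (∀ i → i < T → y i < 2 ^ L) →
            sumℕ T (λ i → 2 ^ (L * i) * y i) < 2 ^ (L * T) ×
            HW (sumℕ T (λ i → 2 ^ (L * i) * y i)) ≡ sumℕ T (HW ∘ y)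
HW-digits L zero    y _      = m^n>0 2 (L * 0) , refl
HW-digits L (suc T) y y<2^L = bound , weight
  where
  ih  = HW-digits L T y (λ i i<T → y<2^L i (m<n⇒m<1+n i<T))
  low = sumℕ T (λ i → 2 ^ (L * i) * y i)
  B   = 2 ^ (L * T)
  weight : HW (low + B * y T) ≡ sumℕ T (HW ∘ y) + HW (y T)
  weight = trans (HW-+-2^* (L * T) low (y T) (proj₁ ih)) (cong (_+ HW (y T)) (proj₂ ih))
  bound : low + B * y T < 2 ^ (L * suc T)
  bound = begin-strict
    low + B * y T      <⟨ +-monoˡ-< (B * y T) (proj₁ ih) ⟩
    B + B * y T        ≡⟨ *-suc B (y T) ⟨
    B * suc (y T)      ≤⟨ *-monoʳ-≤ B (y<2^L T ≤-refl) ⟩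
    B * 2 ^ L          ≡⟨ ^-distribˡ-+-* 2 (L * T) L ⟨
    2 ^ (L * T + L)    ≡⟨ cong (2 ^_) (trans (+-comm (L * T) L) (sym (*-suc L T))) ⟩
    2 ^ (L * suc T)    ∎
    where open ≤-Reasoning

δℕ : ℕ → ℕ → ℕ
δℕ w s = (2 ^ w ∸ 1) * (2 ^ w + 1 ∸ s)

2^n≡1+[2^n∸1] : ∀ n → 2 ^ n ≡ suc (2 ^ n ∸ 1)
2^n≡1+[2^n∸1] n = sym (trans (+-comm 1 (2 ^ n ∸ 1)) (m∸n+n≡m (m^n>0 2 n)))

-- In base 2^w, δℕ w (1 + s) has the digits s and R = 2^w − 1 − s, which are bitwise
-- complements, while δℕ w 0 has both digits equal to 2^w − 1.
δℕ-digits-suc : ∀ w s R → s + R + 1 ≡ 2 ^ w → δℕ w (suc s) ≡ s + 2 ^ w * R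
δℕ-digits-suc w s R eq = subst (λ x → (x ∸ 1) * (x + 1 ∸ suc s) ≡ s + x * R) eq (begin
  (s + R + 1 ∸ 1) * (s + R + 1 + 1 ∸ suc s)   ≡⟨ cong₂ _*_ (m+n∸n≡m (s + R) 1)
                                                   (trans (cong (_∸ suc s) (shift s R)) (m+n∸m≡n (suc s) (R + 1))) ⟩
  (s + R) * (R + 1)                           ≡⟨ expand s R ⟩
  s + (s + R + 1) * R                         ∎)
  where
  open ≡-Reasoning
  shift : ∀ s R → s + R + 1 + 1 ≡ suc s + (R + 1)
  shift = solve-∀
  expand : ∀ s R → (s + R) * (R + 1) ≡ s + (s + R + 1) * R
  expand = solve-∀

δℕ-digits-zero : ∀ w → δℕ w 0 ≡ (2 ^ w ∸ 1) + 2 ^ w * (2 ^ w ∸ 1)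
δℕ-digits-zero w = subst (λ x → (x ∸ 1) * (x + 1) ≡ (x ∸ 1) + x * (x ∸ 1)) (sym (2^n≡1+[2^n∸1] w))
  (expand (2 ^ w ∸ 1))
  where
  expand : ∀ P → P * (suc P + 1) ≡ P + suc P * P
  expand = solve-∀

HW-δℕ : ∀ w s → s ≤ 2 ^ w → HW (δℕ w s) ≡ w + w * indicator (s ≟ 0)
HW-δℕ w zero _ = begin
  HW (δℕ w 0)          ≡⟨ cong HW (δℕ-digits-zero w) ⟩
  HW (P + 2 ^ w * P)   ≡⟨ HW-+-2^* w P P (subst (P <_) (sym (2^n≡1+[2^n∸1] w)) ≤-refl) ⟩
  HW P + HW P          ≡⟨ cong₂ _+_ HW-P HW-P ⟩
  w + w                ≡⟨ cong (w +_) (*-identityʳ w) ⟨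
  w + w * 1            ∎
  where
  open ≡-Reasoning
  P = 2 ^ w ∸ 1
  HW-P : HW P ≡ w
  HW-P = trans (sym (+-identityʳ (HW P)))
    (HW-complement w P 0 (trans (cong (_+ 1) (+-identityʳ P)) (trans (+-comm P 1) (sym (2^n≡1+[2^n∸1] w)))))
HW-δℕ w (suc s) 1+s≤2^w = begin
  HW (δℕ w (suc s))    ≡⟨ cong HW (δℕ-digits-suc w s R s+R+1≡2^w) ⟩
  HW (s + 2 ^ w * R)   ≡⟨ HW-+-2^* w s R 1+s≤2^w ⟩
  HW s + HW R          ≡⟨ HW-complement w s R s+R+1≡2^w ⟩
  w                    ≡⟨ trans (cong (w +_) (*-zeroʳ w)) (+-identityʳ w) ⟨
  w + w * 0            ∎
  where
  open ≡-Reasoning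
  R = 2 ^ w ∸ suc s
  s+R+1≡2^w : s + R + 1 ≡ 2 ^ w
  s+R+1≡2^w = trans (trans (+-comm (s + R) 1) (+-assoc 1 s R)) (m+[n∸m]≡n 1+s≤2^w)

δℕ<2^[2w] : ∀ w s → δℕ w s < 2 ^ (2 * w)
δℕ<2^[2w] w s = begin-strict
  P * (2 ^ w + 1 ∸ s)    ≤⟨ *-monoʳ-≤ P (m∸n≤m (2 ^ w + 1) s) ⟩
  P * (2 ^ w + 1)        <⟨ subst (λ x → (x ∸ 1) * (x + 1) < x * x) (sym (2^n≡1+[2^n∸1] w)) (≤-reflexive (square P)) ⟩
  2 ^ w * 2 ^ w          ≡⟨ ^-distribˡ-+-* 2 w w ⟨
  2 ^ (w + w)            ≡⟨ cong (λ k → 2 ^ (w + k)) (+-identityʳ w) ⟨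
  2 ^ (2 * w)            ∎
  where
  open ≤-Reasoning
  P = 2 ^ w ∸ 1
  square : ∀ P → suc (P * (suc P + 1)) ≡ suc P * suc P
  square = solve-∀

∣⊖∣≡∣-∣ : ∀ m n → ℤ.∣ m ⊖ n ∣ ≡ ∣ m - n ∣
∣⊖∣≡∣-∣ m n with ≤-total m n
... | inj₁ m≤n = trans (ℤ.∣⊖∣-≤ m≤n) (sym (m≤n⇒∣m-n∣≡n∸m m≤n))
... | inj₂ n≤m = trans (ℤ.∣m⊖n∣≡∣n⊖m∣ m n) (trans (ℤ.∣⊖∣-≤ n≤m) (sym (m≤n⇒∣n-m∣≡n∸m n≤m)))

sqDist : ℕ → ℕ → ℕ
sqDist x y = ∣ x - y ∣ * ∣ x - y ∣

sq-diff : ∀ x y → sq (ℤ.+ x ℤ.- ℤ.+ y) ≡ ℤ.+ sqDist x y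
sq-diff x y = begin
  sq (ℤ.+ x ℤ.- ℤ.+ y)                ≡⟨ cong sq (ℤ.m-n≡m⊖n x y) ⟩
  sq (x ⊖ y)                          ≡⟨ sq-abs (x ⊖ y) ⟩
  ℤ.+ (ℤ.∣ x ⊖ y ∣ * ℤ.∣ x ⊖ y ∣)     ≡⟨ cong (λ k → ℤ.+ (k * k)) (∣⊖∣≡∣-∣ x y) ⟩
  ℤ.+ sqDist x y                      ∎
  where
  open ≡-Reasoning
  sq-abs : ∀ i → sq i ≡ ℤ.+ (ℤ.∣ i ∣ * ℤ.∣ i ∣)
  sq-abs (ℤ.+ m)  = sym (ℤ.pos-* m m)
  sq-abs -[1+ m ] = refl

sqDist≡0⇒≡ : ∀ x y → sqDist x y ≡ 0 → x ≡ y
sqDist≡0⇒≡ x y eq = ∣m-n∣≡0⇒m≡n ([ id , id ]′ (m*n≡0⇒m≡0∨n≡0 ∣ x - y ∣ eq))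

≡⇒sqDist≡0 : ∀ {x y} → x ≡ y → sqDist x y ≡ 0
≡⇒sqDist≡0 {x} refl = cong (λ k → k * k) (∣n-n∣≡0 x)

X : ℕ → ℕ
X g = 12 ^ (3 * g + 2)

Sℕ : ℕ → ℕ → ℕ → ℕ → ℕ → ℕ → ℕ → ℕ → ℕ
Sℕ n g v a b c d e =
    sqDist c (X g)
  + sqDist d (a * g)
  + sqDist e (b * g)
  + sqDist (2 ^ n) (2 ^ (g + v))
  + sqDist (2 ^ c) (2 ^ (3 * d + 2 * a))
  + sqDist (2 ^ (c + 1)) (2 ^ (6 * e + 5 * b))

S≡Sℕ : ∀ n g v a b c d e → S n g v a b c d e ≡ ℤ.+ Sℕ n g v a b c d e
S≡Sℕ n g v a b c d e
  rewrite sq-diff c (12 ^ (3 * g + 2)) | sq-diff d (a * g) | sq-diff e (b * g)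
        | sq-diff (2 ^ n) (2 ^ (g + v)) | sq-diff (2 ^ c) (2 ^ (3 * d + 2 * a))
        | sq-diff (2 ^ (c + 1)) (2 ^ (6 * e + 5 * b))
  = refl

δ≡δℕ : ∀ w s → s ≤ 2 ^ w → δ (ℤ.+ s) w ≡ ℤ.+ δℕ w s
δ≡δℕ w s s≤2^w = sym (begin
  ℤ.+ ((2 ^ w ∸ 1) * (2 ^ w + 1 ∸ s))                 ≡⟨ ℤ.pos-* (2 ^ w ∸ 1) (2 ^ w + 1 ∸ s) ⟩
  ℤ.+ (2 ^ w ∸ 1) ℤ.* ℤ.+ (2 ^ w + 1 ∸ s)             ≡⟨ cong₂ ℤ._*_ (pos-∸ (m^n>0 2 w)) (pos-∸ (≤-trans s≤2^w (m≤m+n (2 ^ w) 1))) ⟩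
  (ℤ.+ (2 ^ w) ℤ.- 1ℤ) ℤ.* (ℤ.+ (2 ^ w + 1) ℤ.- ℤ.+ s)  ≡⟨ cong ((ℤ.+ (2 ^ w) ℤ.- 1ℤ) ℤ.*_) (regroup (ℤ.+ (2 ^ w)) (ℤ.+ s)) ⟩
  δ (ℤ.+ s) w                                         ∎)
  where
  open ≡-Reasoning
  pos-∸ : ∀ {a b} → b ≤ a → ℤ.+ (a ∸ b) ≡ ℤ.+ a ℤ.- ℤ.+ b
  pos-∸ {a} {b} b≤a = sym (trans (ℤ.m-n≡m⊖n a b) (ℤ.⊖-≥ b≤a))
  regroup : ∀ x s → (x ℤ.+ 1ℤ) ℤ.- s ≡ (x ℤ.- s) ℤ.+ 1ℤ
  regroup = ℤsolve-∀

2^-injective : ∀ {x y} → 2 ^ x ≡ 2 ^ y → x ≡ y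
2^-injective {x} {y} eq with <-cmp x y
... | tri≈ _ x≡y _ = x≡y
... | tri< x<y _ _ = ⊥-elim (<-irrefl eq (^-monoʳ-< 2 (s≤s (s≤s z≤n)) x<y))
... | tri> _ _ y<x = ⊥-elim (<-irrefl (sym eq) (^-monoʳ-< 2 (s≤s (s≤s z≤n)) y<x))

record Solves (n g v a b c d e : ℕ) : Set where
  field
    c≡X      : c ≡ X g
    d≡ag     : d ≡ a * g
    e≡bg     : e ≡ b * g
    n≡g+v    : n ≡ g + v
    c≡3d+2a  : c ≡ 3 * d + 2 * a
    c+1≡6e+5b : c + 1 ≡ 6 * e + 5 * b
open Solves

Sℕ≡0⇒Solves : ∀ n g v a b c d e → Sℕ n g v a b c d e ≡ 0 → Solves n g v a b c d e
Sℕ≡0⇒Solves n g v a b c d e S≡0 = record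
  { c≡X       = sqDist≡0⇒≡ _ _ z₁
  ; d≡ag      = sqDist≡0⇒≡ _ _ z₂
  ; e≡bg      = sqDist≡0⇒≡ _ _ z₃
  ; n≡g+v     = 2^-injective (sqDist≡0⇒≡ _ _ z₄)
  ; c≡3d+2a   = 2^-injective (sqDist≡0⇒≡ _ _ z₅)
  ; c+1≡6e+5b = 2^-injective (sqDist≡0⇒≡ _ _ z₆)
  }
  where
  z₁₋₅ = m+n≡0⇒m≡0 _ S≡0
  z₆   = m+n≡0⇒n≡0 _ S≡0
  z₁₋₄ = m+n≡0⇒m≡0 _ z₁₋₅
  z₅   = m+n≡0⇒n≡0 _ z₁₋₅
  z₁₋₃ = m+n≡0⇒m≡0 _ z₁₋₄
  z₄   = m+n≡0⇒n≡0 _ z₁₋₄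
  z₁₋₂ = m+n≡0⇒m≡0 _ z₁₋₃
  z₃   = m+n≡0⇒n≡0 _ z₁₋₃
  z₁   = m+n≡0⇒m≡0 _ z₁₋₂
  z₂   = m+n≡0⇒n≡0 _ z₁₋₂

Solves⇒Sℕ≡0 : ∀ {n g v a b c d e} → Solves n g v a b c d e → Sℕ n g v a b c d e ≡ 0
Solves⇒Sℕ≡0 s
  rewrite ≡⇒sqDist≡0 (c≡X s) | ≡⇒sqDist≡0 (d≡ag s) | ≡⇒sqDist≡0 (e≡bg s)
        | ≡⇒sqDist≡0 (cong (2 ^_) (n≡g+v s)) | ≡⇒sqDist≡0 (cong (2 ^_) (c≡3d+2a s))
        | ≡⇒sqDist≡0 (cong (2 ^_) (c+1≡6e+5b s))
  = refl

zerosAt : ℕ → ℕ → ℕ → ℕ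
zerosAt n t g =
  sumℕ t λ v → sumℕ t λ a → sumℕ t λ b → sumℕ t λ c → sumℕ t λ d → sumℕ t λ e →
    indicator (Sℕ n g v a b c d e ≟ 0)

¬Solves⇒indicator≡0 : ∀ {n g} v a b c d e → ¬ Solves n g v a b c d e → indicator (Sℕ n g v a b c d e ≟ 0) ≡ 0
¬Solves⇒indicator≡0 {n} {g} v a b c d e ¬sol = indicator-no (Sℕ n g v a b c d e ≟ 0) (¬sol ∘ Sℕ≡0⇒Solves n g v a b c d e)

zerosAt-none : ∀ {n t g} → (∀ {v a b c d e} → ¬ Solves n g v a b c d e) → zerosAt n t g ≡ 0
zerosAt-none {t = t} ¬sol =
  sumℕ-zero t λ v _ → sumℕ-zero t λ a _ → sumℕ-zero t λ b _ → sumℕ-zero t λ c _ →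
  sumℕ-zero t λ d _ → sumℕ-zero t λ e _ → ¬Solves⇒indicator≡0 v a b c d e ¬sol

zerosAt-unique : ∀ {n t g v₀ a₀ b₀ c₀ d₀ e₀} → Solves n g v₀ a₀ b₀ c₀ d₀ e₀ →
  (∀ {v a b c d e} → Solves n g v a b c d e →
     v ≡ v₀ × a ≡ a₀ × b ≡ b₀ × c ≡ c₀ × d ≡ d₀ × e ≡ e₀) →
  v₀ < t → a₀ < t → b₀ < t → c₀ < t → d₀ < t → e₀ < t → zerosAt n t g ≡ 1
zerosAt-unique {t = t} {g} {v₀} {a₀} {b₀} {c₀} {d₀} {e₀} sol unique v₀<t a₀<t b₀<t c₀<t d₀<t e₀<t =
  trans (sumℕ-point t v₀ v₀<t λ v _ v≢v₀ →
           sumℕ-zero t λ a _ → sumℕ-zero t λ b _ → sumℕ-zero t λ c _ → sumℕ-zero t λ d _ →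
           sumℕ-zero t λ e _ → ¬Solves⇒indicator≡0 v a b c d e (v≢v₀ ∘ proj₁ ∘ unique)) (
  trans (sumℕ-point t a₀ a₀<t λ a _ a≢a₀ →
           sumℕ-zero t λ b _ → sumℕ-zero t λ c _ → sumℕ-zero t λ d _ → sumℕ-zero t λ e _ →
           ¬Solves⇒indicator≡0 v₀ a b c d e (a≢a₀ ∘ proj₁ ∘ proj₂ ∘ unique)) (
  trans (sumℕ-point t b₀ b₀<t λ b _ b≢b₀ →
           sumℕ-zero t λ c _ → sumℕ-zero t λ d _ → sumℕ-zero t λ e _ →
           ¬Solves⇒indicator≡0 v₀ a₀ b c d e (b≢b₀ ∘ proj₁ ∘ proj₂ ∘ proj₂ ∘ unique)) (
  trans (sumℕ-point t c₀ c₀<t λ c _ c≢c₀ →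
           sumℕ-zero t λ d _ → sumℕ-zero t λ e _ →
           ¬Solves⇒indicator≡0 v₀ a₀ b₀ c d e (c≢c₀ ∘ proj₁ ∘ proj₂ ∘ proj₂ ∘ proj₂ ∘ unique)) (
  trans (sumℕ-point t d₀ d₀<t λ d _ d≢d₀ →
           sumℕ-zero t λ e _ → ¬Solves⇒indicator≡0 v₀ a₀ b₀ c₀ d e (d≢d₀ ∘ proj₁ ∘ proj₂ ∘ proj₂ ∘ proj₂ ∘ proj₂ ∘ unique)) (
  trans (sumℕ-point t e₀ e₀<t λ e _ e≢e₀ →
           ¬Solves⇒indicator≡0 v₀ a₀ b₀ c₀ d₀ e (e≢e₀ ∘ proj₂ ∘ proj₂ ∘ proj₂ ∘ proj₂ ∘ proj₂ ∘ unique))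
  (indicator-yes (_ ≟ 0) (Solves⇒Sℕ≡0 sol)))))))

n<tt : ∀ n → n < tt n
n<tt n = begin-strict
  n                 <⟨ n<2^n n ⟩
  2 ^ n             ≤⟨ ^-monoʳ-≤ 2 (≤-trans (m≤n*m n 3) (m≤m+n (3 * n) 3)) ⟩
  2 ^ (3 * n + 3)   ≤⟨ ^-monoˡ-≤ (3 * n + 3) (m≤m+n 2 10) ⟩
  tt n              ∎
  where open ≤-Reasoning

-- Every entry of S is at most 2^(11t) when all coordinates are below t; hence S ≤ 6·2^(22t) < 2^w.
module _ {t : ℕ} where
  private
    B = 2 ^ (11 * t)

    2^≤B : ∀ {x} → x ≤ 11 * t → 2 ^ x ≤ B
    2^≤B = ^-monoʳ-≤ 2

    t≤11t : t ≤ 11 * t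
    t≤11t = m≤m+n t (10 * t)

    <t⇒≤B : ∀ {x} → x < t → x ≤ B
    <t⇒≤B {x} x<t = ≤-trans (<⇒≤ (n<2^n x)) (2^≤B (≤-trans (<⇒≤ x<t) t≤11t))

    product≤B : ∀ {x y} → x < t → y < t → x * y ≤ B
    product≤B {x} {y} x<t y<t = begin
      x * y           ≤⟨ *-mono-≤ (<⇒≤ (<-trans x<t (n<2^n t))) (<⇒≤ (<-trans y<t (n<2^n t))) ⟩
      2 ^ t * 2 ^ t   ≡⟨ ^-distribˡ-+-* 2 t t ⟨
      2 ^ (t + t)     ≤⟨ 2^≤B (+-monoʳ-≤ t (m≤m+n t (9 * t))) ⟩
      B               ∎
      where open ≤-Reasoning

    X≤B : ∀ {g} → g < t → X g ≤ B
    X≤B {g} g<t = begin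
      12 ^ (3 * g + 2)        ≡⟨ ^-distribˡ-+-* 12 (3 * g) 2 ⟩
      12 ^ (3 * g) * 144      ≡⟨ cong (_* 144) (^-*-assoc 12 3 g) ⟨
      1728 ^ g * 144          ≤⟨ *-mono-≤ (^-monoˡ-≤ g (m≤m+n 1728 320)) (m≤m+n 144 112) ⟩
      2048 ^ g * 2 ^ 8        ≡⟨ cong (_* 2 ^ 8) (^-*-assoc 2 11 g) ⟩
      2 ^ (11 * g) * 2 ^ 8    ≡⟨ ^-distribˡ-+-* 2 (11 * g) 8 ⟨
      2 ^ (11 * g + 8)        ≤⟨ 2^≤B 11g+8≤11t ⟩
      B                       ∎
      where
      open ≤-Reasoning
      11g+8≤11t : 11 * g + 8 ≤ 11 * t
      11g+8≤11t = ≤-trans (+-monoʳ-≤ (11 * g) (m≤m+n 8 3))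
                          (≤-trans (≤-reflexive (trans (+-comm (11 * g) 11) (sym (*-suc 11 g)))) (*-monoʳ-≤ 11 g<t))

    linear≤11t : ∀ {x y} k l → k + l ≤ 11 → x < t → y < t → k * x + l * y ≤ 11 * t
    linear≤11t {x} {y} k l k+l≤11 x<t y<t = begin
      k * x + l * y   ≤⟨ +-mono-≤ (*-monoʳ-≤ k (<⇒≤ x<t)) (*-monoʳ-≤ l (<⇒≤ y<t)) ⟩
      k * t + l * t   ≡⟨ *-distribʳ-+ t k l ⟨
      (k + l) * t     ≤⟨ *-monoˡ-≤ t k+l≤11 ⟩
      11 * t          ∎
      where open ≤-Reasoning

    sqDist≤B² : ∀ {x y} → x ≤ B → y ≤ B → sqDist x y ≤ B * B
    sqDist≤B² {x} {y} x≤B y≤B = *-mono-≤ dist≤B dist≤B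
      where dist≤B = ≤-trans (∣m-n∣≤m⊔n x y) (⊔-lub x≤B y≤B)

    6B²≤2^[22t+27] : 6 * (B * B) ≤ 2 ^ (22 * t + 27)
    6B²≤2^[22t+27] = begin
      6 * (B * B)                   ≤⟨ *-monoˡ-≤ (B * B) {6} {8} (m≤m+n 6 2) ⟩
      2 ^ 3 * (B * B)               ≡⟨ cong (2 ^ 3 *_) (^-distribˡ-+-* 2 (11 * t) (11 * t)) ⟨
      2 ^ 3 * 2 ^ (11 * t + 11 * t) ≡⟨ ^-distribˡ-+-* 2 3 (11 * t + 11 * t) ⟨
      2 ^ (3 + (11 * t + 11 * t))   ≤⟨ ^-monoʳ-≤ 2 (≤-trans (≤-reflexive (regroup t)) (+-monoʳ-≤ (22 * t) (m≤m+n 3 24))) ⟩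
      2 ^ (22 * t + 27)             ∎
      where
      open ≤-Reasoning
      regroup : ∀ t → 3 + (11 * t + 11 * t) ≡ 22 * t + 3
      regroup = solve-∀

  Sℕ≤2^w : ∀ {n g v a b c d e} → n < t → g < t → v < t → a < t → b < t → c < t → d < t → e < t →
           Sℕ n g v a b c d e ≤ 2 ^ (22 * t + 27)
  Sℕ≤2^w {n} {g} {v} {a} {b} {c} {d} {e} n<t g<t v<t a<t b<t c<t d<t e<t = begin
    Sℕ n g v a b c d e               ≤⟨ +-mono-≤ (+-mono-≤ (+-mono-≤ (+-mono-≤ (+-mono-≤ s₁ s₂) s₃) s₄) s₅) s₆ ⟩
    B * B + B * B + B * B + B * B + B * B + B * B  ≡⟨ six (B * B) ⟩
    6 * (B * B)                      ≤⟨ 6B²≤2^[22t+27] ⟩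
    2 ^ (22 * t + 27)                ∎
    where
    open ≤-Reasoning
    six : ∀ x → x + x + x + x + x + x ≡ 6 * x
    six = solve-∀
    s₁ = sqDist≤B² (<t⇒≤B c<t) (X≤B g<t)
    s₂ = sqDist≤B² (<t⇒≤B d<t) (product≤B a<t g<t)
    s₃ = sqDist≤B² (<t⇒≤B e<t) (product≤B b<t g<t)
    s₄ = sqDist≤B² (2^≤B (≤-trans (<⇒≤ n<t) t≤11t))
                   (2^≤B (subst₂ (λ x y → x + y ≤ 11 * t) (*-identityˡ g) (*-identityˡ v) (linear≤11t 1 1 (m≤m+n 2 9) g<t v<t)))
    s₅ = sqDist≤B² (2^≤B (≤-trans (<⇒≤ c<t) t≤11t)) (2^≤B (linear≤11t 3 2 (m≤m+n 5 6) d<t a<t))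
    s₆ = sqDist≤B² (2^≤B (≤-trans (≤-reflexive (+-comm c 1)) (≤-trans c<t t≤11t)))
                   (2^≤B (linear≤11t 6 5 ≤-refl e<t b<t))

nest7 : ℕ → (ℕ → ℕ → ℕ → ℕ → ℕ → ℕ → ℕ → ℕ) → ℕ
nest7 t f =
  sumℕ t λ g → sumℕ t λ v → sumℕ t λ a → sumℕ t λ b → sumℕ t λ c → sumℕ t λ d → sumℕ t λ e →
    f g v a b c d e

seventh-power : ∀ x → x * x * x * x * x * x * x ≡ x ^ 7
seventh-power = solve 1 (λ x → x :* x :* x :* x :* x :* x :* x := x :^ 7) refl
  where open +-*-Solver

β-horner : ∀ t a₁ a₂ a₃ a₄ a₅ a₆ a₇ →
           β t a₁ a₂ a₃ a₄ a₅ a₆ a₇ ≡ a₁ + t * (a₂ + t * (a₃ + t * (a₄ + t * (a₅ + t * (a₆ + t * a₇)))))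
β-horner = solve 8 (λ t a₁ a₂ a₃ a₄ a₅ a₆ a₇ →
    a₁ :+ a₂ :* t :+ a₃ :* t :^ 2 :+ a₄ :* t :^ 3 :+ a₅ :* t :^ 4 :+ a₆ :* t :^ 5 :+ a₇ :* t :^ 6
  := a₁ :+ t :* (a₂ :+ t :* (a₃ :+ t :* (a₄ :+ t :* (a₅ :+ t :* (a₆ :+ t :* a₇)))))) refl
  where open +-*-Solver

module BaseDigits (t : ℕ) .{{_ : NonZero t}} where
  rem quo : ℕ → ℕ
  rem N = N % t
  quo N = N / t

  -- The base-t digits a₁ … a₇ of N (the last one absorbing everything above t⁶).
  onDigits : ∀ {A : Set} → (ℕ → ℕ → ℕ → ℕ → ℕ → ℕ → ℕ → A) → ℕ → A
  onDigits f N = f (rem N) (rem (quo N)) (rem (quo (quo N))) (rem (quo (quo (quo N))))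
                   (rem (quo (quo (quo (quo N))))) (rem (quo (quo (quo (quo (quo N))))))
                   (quo (quo (quo (quo (quo (quo N))))))

  nest7-flatten : ∀ f → nest7 t f ≡ sumℕ (t ^ 7) (onDigits f)
  nest7-flatten f = begin
    nest7 t f
      ≡⟨ (under λ g → under λ v → under λ a → under λ b → under λ c → sumℕ-pair t t (f g v a b c)) ⟩
    (sumℕ t λ g → sumℕ t λ v → sumℕ t λ a → sumℕ t λ b → sumℕ t λ c → sumℕ (t * t) λ N →
       f g v a b c (rem N) (quo N))
      ≡⟨ (under λ g → under λ v → under λ a → under λ b → sumℕ-pair t (t * t) (λ c N → f g v a b c (rem N) (quo N))) ⟩
    (sumℕ t λ g → sumℕ t λ v → sumℕ t λ a → sumℕ t λ b → sumℕ (t * t * t) λ N →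
       f g v a b (rem N) (rem (quo N)) (quo (quo N)))
      ≡⟨ (under λ g → under λ v → under λ a → sumℕ-pair t (t * t * t) (λ b N → f g v a b (rem N) (rem (quo N)) (quo (quo N)))) ⟩
    (sumℕ t λ g → sumℕ t λ v → sumℕ t λ a → sumℕ (t * t * t * t) λ N →
       f g v a (rem N) (rem (quo N)) (rem (quo (quo N))) (quo (quo (quo N))))
      ≡⟨ (under λ g → under λ v → sumℕ-pair t (t * t * t * t) (λ a N →
           f g v a (rem N) (rem (quo N)) (rem (quo (quo N))) (quo (quo (quo N))))) ⟩
    (sumℕ t λ g → sumℕ t λ v → sumℕ (t * t * t * t * t) λ N →
       f g v (rem N) (rem (quo N)) (rem (quo (quo N))) (rem (quo (quo (quo N)))) (quo (quo (quo (quo N)))))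
      ≡⟨ (under λ g → sumℕ-pair t (t * t * t * t * t) (λ v N →
           f g v (rem N) (rem (quo N)) (rem (quo (quo N))) (rem (quo (quo (quo N)))) (quo (quo (quo (quo N)))))) ⟩
    (sumℕ t λ g → sumℕ (t * t * t * t * t * t) λ N →
       f g (rem N) (rem (quo N)) (rem (quo (quo N))) (rem (quo (quo (quo N))))
           (rem (quo (quo (quo (quo N))))) (quo (quo (quo (quo (quo N))))))
      ≡⟨ sumℕ-pair t (t * t * t * t * t * t) (λ g N →
           f g (rem N) (rem (quo N)) (rem (quo (quo N))) (rem (quo (quo (quo N))))
               (rem (quo (quo (quo (quo N))))) (quo (quo (quo (quo (quo N)))))) ⟩
    sumℕ (t * t * t * t * t * t * t) (onDigits f)
      ≡⟨ cong (λ k → sumℕ k (onDigits f)) (seventh-power t) ⟩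
    sumℕ (t ^ 7) (onDigits f)
      ∎
    where
    open ≡-Reasoning
    under : ∀ {F G : ℕ → ℕ} → (∀ i → F i ≡ G i) → sumℕ t F ≡ sumℕ t G
    under F≡G = sumℕ-cong t (λ i _ → F≡G i)

  β-onDigits : ∀ N → onDigits (β t) N ≡ N
  β-onDigits N = begin
    onDigits (β t) N
      ≡⟨ β-horner t _ _ _ _ _ _ _ ⟩
    rem N + t * (rem N₁ + t * (rem N₂ + t * (rem N₃ + t * (rem N₄ + t * (rem N₅ + t * N₆)))))
      ≡⟨ cong (λ x → rem N + t * (rem N₁ + t * (rem N₂ + t * (rem N₃ + t * (rem N₄ + t * x))))) (split N₅) ⟨
    rem N + t * (rem N₁ + t * (rem N₂ + t * (rem N₃ + t * (rem N₄ + t * N₅))))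
      ≡⟨ cong (λ x → rem N + t * (rem N₁ + t * (rem N₂ + t * (rem N₃ + t * x)))) (split N₄) ⟨
    rem N + t * (rem N₁ + t * (rem N₂ + t * (rem N₃ + t * N₄)))
      ≡⟨ cong (λ x → rem N + t * (rem N₁ + t * (rem N₂ + t * x))) (split N₃) ⟨
    rem N + t * (rem N₁ + t * (rem N₂ + t * N₃))
      ≡⟨ cong (λ x → rem N + t * (rem N₁ + t * x)) (split N₂) ⟨
    rem N + t * (rem N₁ + t * N₂)
      ≡⟨ cong (λ x → rem N + t * x) (split N₁) ⟨
    rem N + t * N₁
      ≡⟨ split N ⟨
    N ∎
    where
    open ≡-Reasoning
    N₁ = quo N
    N₂ = quo N₁
    N₃ = quo N₂
    N₄ = quo N₃
    N₅ = quo N₄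
    N₆ = quo N₅
    split : ∀ N → N ≡ rem N + t * quo N
    split N = trans (m≡m%n+[m/n]*n N t) (cong (rem N +_) (*-comm (quo N) t))

sumℤ-pos : ∀ k {F f} → (∀ i → i < k → F i ≡ ℤ.+ f i) → sumℤ k F ≡ ℤ.+ sumℕ k f
sumℤ-pos zero    _    = refl
sumℤ-pos (suc k) {f = f} F≡f =
  trans (cong₂ ℤ._+_ (sumℤ-pos k (λ i i<k → F≡f i (m<n⇒m<1+n i<k))) (F≡f k ≤-refl))
        (sym (ℤ.pos-+ (sumℕ k f) (f k)))

tt≢0 : ∀ n → NonZero (tt n)
tt≢0 n = m^n≢0 12 (3 * n + 3)

module Expansion (n : ℕ) where
  private
    t = tt n
    w = ww n
    instance _ = tt≢0 n
  open BaseDigits t public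

  Mℕ : ℕ
  Mℕ = sumℕ (t ^ 7) (λ N → 2 ^ (2 * w * N) * δℕ w (onDigits (Sℕ n) N))

  onDigits-Sℕ≤2^w : ∀ {N} → N < t ^ 7 → onDigits (Sℕ n) N ≤ 2 ^ w
  onDigits-Sℕ≤2^w {N} N<t^7 = Sℕ≤2^w (n<tt n) (rem<t N) (rem<t _) (rem<t _) (rem<t _) (rem<t _) (rem<t _)
    (quo< (quo< (quo< (quo< (quo< (quo< (subst (N <_) (sym (seventh-power t)) N<t^7)))))))
    where
    rem<t : ∀ N → rem N < t
    rem<t N = m%n<n N t
    quo< : ∀ {N K} → N < K * t → quo N < K
    quo< = m<n*o⇒m/o<n

  M≡Mℕ : M n t w ≡ ℤ.+ Mℕ
  M≡Mℕ = begin
    M n t w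
      ≡⟨ lift (λ g g<t → lift λ v v<t → lift λ a a<t → lift λ b b<t → lift λ c c<t → lift λ d d<t → lift λ e e<t →
           term g v a b c d e (Sℕ≤2^w (n<tt n) g<t v<t a<t b<t c<t d<t e<t)) ⟩
    ℤ.+ nest7 t (λ g v a b c d e → 2 ^ (2 * w * β t g v a b c d e) * δℕ w (Sℕ n g v a b c d e))
      ≡⟨ cong ℤ.+_ (nest7-flatten _) ⟩
    ℤ.+ sumℕ (t ^ 7) (onDigits (λ g v a b c d e → 2 ^ (2 * w * β t g v a b c d e) * δℕ w (Sℕ n g v a b c d e)))
      ≡⟨ cong ℤ.+_ (sumℕ-cong (t ^ 7) (λ N _ → cong (λ k → 2 ^ (2 * w * k) * δℕ w (onDigits (Sℕ n) N)) (β-onDigits N))) ⟩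
    ℤ.+ Mℕ
      ∎
    where
    open ≡-Reasoning
    lift : ∀ {F f} → (∀ i → i < t → F i ≡ ℤ.+ f i) → sumℤ t F ≡ ℤ.+ sumℕ t f
    lift = sumℤ-pos t
    term : ∀ g v a b c d e → Sℕ n g v a b c d e ≤ 2 ^ w →
           ℤ.+ (2 ^ (2 * w * β t g v a b c d e)) ℤ.* δ (S n g v a b c d e) w ≡
           ℤ.+ (2 ^ (2 * w * β t g v a b c d e) * δℕ w (Sℕ n g v a b c d e))
    term g v a b c d e S≤2^w rewrite S≡Sℕ n g v a b c d e | δ≡δℕ w _ S≤2^w =
      sym (ℤ.pos-* (2 ^ (2 * w * β t g v a b c d e)) (δℕ w (Sℕ n g v a b c d e)))

  HW-Mℕ : HW Mℕ ≡ w * (t ^ 7 + sumℕ t (zerosAt n t))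
  HW-Mℕ = begin
    HW Mℕ
      ≡⟨ proj₂ (HW-digits (2 * w) (t ^ 7) (δℕ w ∘ s) (λ N _ → δℕ<2^[2w] w (s N))) ⟩
    sumℕ (t ^ 7) (λ N → HW (δℕ w (s N)))
      ≡⟨ sumℕ-cong (t ^ 7) (λ N N<t^7 → HW-δℕ w (s N) (onDigits-Sℕ≤2^w N<t^7)) ⟩
    sumℕ (t ^ 7) (λ N → w + w * indicator (s N ≟ 0))
      ≡⟨ sumℕ-+ (t ^ 7) (λ _ → w) (λ N → w * indicator (s N ≟ 0)) ⟩
    sumℕ (t ^ 7) (λ _ → w) + sumℕ (t ^ 7) (λ N → w * indicator (s N ≟ 0))
      ≡⟨ cong₂ _+_ (sumℕ-const (t ^ 7) w) (sumℕ-*ˡ (t ^ 7) w (λ N → indicator (s N ≟ 0))) ⟩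
    w * t ^ 7 + w * sumℕ (t ^ 7) (λ N → indicator (s N ≟ 0))
      ≡⟨ cong (λ k → w * t ^ 7 + w * k) (nest7-flatten (λ g v a b c d e → indicator (Sℕ n g v a b c d e ≟ 0))) ⟨
    w * t ^ 7 + w * sumℕ t (zerosAt n t)
      ≡⟨ *-distribˡ-+ w (t ^ 7) _ ⟨
    w * (t ^ 7 + sumℕ t (zerosAt n t))
      ∎
    where
    open ≡-Reasoning
    s = onDigits (Sℕ n)

k*nCk≡n*[n-1]C[k-1] : ∀ n k → suc k * (suc n C suc k) ≡ suc n * (n C k)
k*nCk≡n*[n-1]C[k-1] zero    zero    = refl
k*nCk≡n*[n-1]C[k-1] zero    (suc k) =
  trans (cong (suc (suc k) *_) (k>n⇒nCk≡0 {1} {suc (suc k)} (s≤s (s≤s z≤n)))) (*-zeroʳ (suc (suc k)))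
k*nCk≡n*[n-1]C[k-1] (suc n) zero    = trans (+-identityʳ _) (trans (nC1≡n (suc (suc n))) (sym (*-identityʳ (suc (suc n)))))
k*nCk≡n*[n-1]C[k-1] (suc n) (suc k) = begin
  (2 + k) * ((2 + n) C (2 + k))              ≡⟨ cong ((2 + k) *_) (nCk+nC[k+1]≡[n+1]C[k+1] (suc n) (suc k)) ⟨
  (2 + k) * (A + B)                          ≡⟨ split₁ k A B ⟩
  (1 + k) * A + A + (2 + k) * B              ≡⟨ cong₂ (λ x y → x + A + y) (k*nCk≡n*[n-1]C[k-1] n k) (k*nCk≡n*[n-1]C[k-1] n (suc k)) ⟩
  (1 + n) * C′ + A + (1 + n) * D             ≡⟨ split₂ n A C′ D ⟩
  (1 + n) * (C′ + D) + A                     ≡⟨ cong (λ x → (1 + n) * x + A) (nCk+nC[k+1]≡[n+1]C[k+1] n k) ⟩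
  (1 + n) * A + A                            ≡⟨ +-comm ((1 + n) * A) A ⟩
  (2 + n) * A                                ∎
  where
  open ≡-Reasoning
  A  = suc n C suc k
  B  = suc n C suc (suc k)
  C′ = n C k
  D  = n C suc k
  split₁ : ∀ k A B → (2 + k) * (A + B) ≡ (1 + k) * A + A + (2 + k) * B
  split₁ = solve-∀
  split₂ : ∀ n A C D → (1 + n) * C + A + (1 + n) * D ≡ (1 + n) * (C + D) + A
  split₂ = solve-∀

p∣pCk : ∀ {p k} → Prime p → 0 < k → k < p → p ∣ p C k
p∣pCk {suc n} {suc k} p-prime _ k<p
  with euclidsLemma (suc k) (suc n C suc k) p-prime
         (divides (n C k) (trans (k*nCk≡n*[n-1]C[k-1] n k) (*-comm (suc n) (n C k))))
... | inj₁ p∣k = ⊥-elim (<-irrefl refl (<-≤-trans k<p (∣⇒≤ p∣k)))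
... | inj₂ p∣C = p∣C

module FreshmansDream {c ℓ} (R : CommutativeSemiring c ℓ) where
  module R = CommutativeSemiring R
  open R using (Carrier; _≈_; 0#) renaming (_+_ to _⊕_)
  open import Algebra.Properties.Semiring.Exp R.semiring public using () renaming (_^_ to _^ᴿ_)
  open import Algebra.Properties.CommutativeMonoid.Mult R.+-commutativeMonoid using (×-distrib-+; ×-assocˡ; ×-homo-1)
  open import Algebra.Properties.CommutativeMonoid.Mult R.+-commutativeMonoid public using () renaming (_×_ to _·_)
  open import Algebra.Properties.Monoid.Sum R.+-monoid using (sum)
  open import Algebra.Properties.CommutativeSemiring.Binomial R using (theorem; binomialTerm)
  open import Relation.Binary.Reasoning.Setoid R.setoid

  ·-zeroʳ : ∀ p → p · 0# ≈ 0#
  ·-zeroʳ zero    = R.refl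
  ·-zeroʳ (suc p) = R.trans (R.+-identityˡ _) (·-zeroʳ p)

  sum-multiples+last : ∀ p n (f : Fin (suc n) → Carrier) →
    (∀ i → toℕ i < n → ∃ λ r → f i ≈ p · r) → ∃ λ r → sum f ≈ p · r ⊕ f (fromℕ n)
  sum-multiples+last p zero    f _ = 0# , (begin
    f zero ⊕ 0#        ≈⟨ R.+-comm (f zero) 0# ⟩
    0# ⊕ f zero        ≈⟨ R.+-congʳ (·-zeroʳ p) ⟨
    p · 0# ⊕ f zero    ∎)
  sum-multiples+last p (suc n) f multiple
    with r₀ , f₀≈ ← multiple zero (s≤s z≤n)
       | r , rest≈ ← sum-multiples+last p n (f ∘ suc) (λ i i<n → multiple (suc i) (s≤s i<n)) =
    r₀ ⊕ r , (begin
      f zero ⊕ sum (f ∘ suc)                   ≈⟨ R.+-cong f₀≈ rest≈ ⟩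
      p · r₀ ⊕ (p · r ⊕ f (fromℕ (suc n)))     ≈⟨ R.+-assoc (p · r₀) (p · r) _ ⟨
      p · r₀ ⊕ p · r ⊕ f (fromℕ (suc n))       ≈⟨ R.+-congʳ (×-distrib-+ r₀ r p) ⟨
      p · (r₀ ⊕ r) ⊕ f (fromℕ (suc n))         ∎)

  -- All inner binomial coefficients of a prime exponent are divisible by it.
  freshmansDream : ∀ {p} → Prime p → ∀ x y → ∃ λ r → (x ⊕ y) ^ᴿ p ≈ y ^ᴿ p ⊕ (p · r ⊕ x ^ᴿ p)
  freshmansDream {suc n} p-prime x y = r , (begin
      (x ⊕ y) ^ᴿ suc n                                     ≈⟨ theorem (suc n) x y ⟩
      binomialTerm x y (suc n) zero ⊕ sum (binomialTerm x y (suc n) ∘ suc)   ≈⟨ R.+-cong first inner≈ ⟩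
      y ^ᴿ suc n ⊕ (suc n · r ⊕ binomialTerm x y (suc n) (suc (fromℕ n)))     ≈⟨ R.+-congˡ (R.+-congˡ last) ⟩
      y ^ᴿ suc n ⊕ (suc n · r ⊕ x ^ᴿ suc n)                 ∎)
    where
    first : binomialTerm x y (suc n) zero ≈ y ^ᴿ suc n
    first = R.trans (×-homo-1 _) (R.*-identityˡ _)
    last : binomialTerm x y (suc n) (suc (fromℕ n)) ≈ x ^ᴿ suc n
    last rewrite toℕ-fromℕ n | nCn≡1 (suc n) | n∸n≡0 n = R.trans (×-homo-1 _) (R.*-identityʳ _)
    innerMultiple : ∀ i → toℕ i < n → ∃ λ r → binomialTerm x y (suc n) (suc i) ≈ suc n · r
    innerMultiple i i<n with divides q C≡q*p ← p∣pCk p-prime (s≤s z≤n) (s≤s i<n) =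
      q · monomial , (begin
        (suc n C suc (toℕ i)) · monomial   ≡⟨ cong (_· monomial) (trans C≡q*p (*-comm q (suc n))) ⟩
        (suc n * q) · monomial             ≈⟨ ×-assocˡ monomial (suc n) q ⟨
        suc n · (q · monomial)             ∎)
      where monomial = x ^ᴿ suc (toℕ i) R.* y ^ᴿ (n ∸ toℕ i)
    inner = sum-multiples+last (suc n) n (binomialTerm x y (suc n) ∘ suc) innerMultiple
    r = proj₁ inner
    inner≈ = proj₂ inner

infix 4 _≡_mod_
record _≡_mod_ (x y : ℤ) (p : ℕ) : Set where
  constructor divides-difference
  field
    ∣x-y : ℤ.+ p ∣ℤ x ℤ.- y
open _≡_mod_

module _ {p : ℕ} where
  ≡⇒≡-mod : ∀ {x y} → x ≡ y → x ≡ y mod p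
  ≡⇒≡-mod {x} refl = divides-difference (ℤ∣.divides 0ℤ (ℤ.+-inverseʳ x))

  ≡-mod-sym : ∀ {x y} → x ≡ y mod p → y ≡ x mod p
  ≡-mod-sym {x} {y} (divides-difference p∣x-y) =
    divides-difference (subst (ℤ.+ p ∣ℤ_) (negate x y) (ℤ∣.∣m⇒∣-m p∣x-y))
    where
    negate : ∀ x y → ℤ.- (x ℤ.- y) ≡ y ℤ.- x
    negate = ℤsolve-∀

  ≡-mod-trans : ∀ {x y z} → x ≡ y mod p → y ≡ z mod p → x ≡ z mod p
  ≡-mod-trans {x} {y} {z} (divides-difference p∣x-y) (divides-difference p∣y-z) =
    divides-difference (subst (ℤ.+ p ∣ℤ_) (telescope x y z) (ℤ∣.∣m∣n⇒∣m+n p∣x-y p∣y-z))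
    where
    telescope : ∀ x y z → (x ℤ.- y) ℤ.+ (y ℤ.- z) ≡ x ℤ.- z
    telescope = ℤsolve-∀

  ≡-mod-+ : ∀ {x y x′ y′} → x ≡ y mod p → x′ ≡ y′ mod p → x ℤ.+ x′ ≡ y ℤ.+ y′ mod p
  ≡-mod-+ {x} {y} {x′} {y′} (divides-difference p∣x-y) (divides-difference p∣x′-y′) =
    divides-difference (subst (ℤ.+ p ∣ℤ_) (interchange x y x′ y′) (ℤ∣.∣m∣n⇒∣m+n p∣x-y p∣x′-y′))
    where
    interchange : ∀ x y x′ y′ → (x ℤ.- y) ℤ.+ (x′ ℤ.- y′) ≡ (x ℤ.+ x′) ℤ.- (y ℤ.+ y′)
    interchange = ℤsolve-∀

  ≡-mod-neg : ∀ {x y} → x ≡ y mod p → ℤ.- x ≡ ℤ.- y mod p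
  ≡-mod-neg {x} {y} (divides-difference p∣x-y) =
    divides-difference (subst (ℤ.+ p ∣ℤ_) (negate x y) (ℤ∣.∣m⇒∣-m p∣x-y))
    where
    negate : ∀ x y → ℤ.- (x ℤ.- y) ≡ ℤ.- x ℤ.- ℤ.- y
    negate = ℤsolve-∀

  ≡-mod-* : ∀ {x y x′ y′} → x ≡ y mod p → x′ ≡ y′ mod p → x ℤ.* x′ ≡ y ℤ.* y′ mod p
  ≡-mod-* {x} {y} {x′} {y′} (divides-difference p∣x-y) (divides-difference p∣x′-y′) =
    divides-difference (subst (ℤ.+ p ∣ℤ_) (expand x y x′ y′)
      (ℤ∣.∣m∣n⇒∣m+n (ℤ∣.∣n⇒∣m*n x′ p∣x-y) (ℤ∣.∣n⇒∣m*n y p∣x′-y′)))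
    where
    expand : ∀ x y x′ y′ → x′ ℤ.* (x ℤ.- y) ℤ.+ y ℤ.* (x′ ℤ.- y′) ≡ x ℤ.* x′ ℤ.- y ℤ.* y′
    expand = ℤsolve-∀

  ≡-mod-^ : ∀ {x y} n → x ≡ y mod p → x ℤ.^ n ≡ y ℤ.^ n mod p
  ≡-mod-^ zero    _   = ≡⇒≡-mod refl
  ≡-mod-^ (suc n) x≡y = ≡-mod-* x≡y (≡-mod-^ n x≡y)

  multiple≡0 : ∀ k → ℤ.+ p ℤ.* k ≡ 0ℤ mod p
  multiple≡0 k = divides-difference (ℤ∣.divides k (trans (ℤ.+-identityʳ _) (ℤ.*-comm (ℤ.+ p) k)))

  ≡0-mod⇒∣ : ∀ {a} → ℤ.+ a ≡ 0ℤ mod p → p ∣ a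
  ≡0-mod⇒∣ {a} (divides-difference p∣a-0) = subst (p ∣_) (cong ℤ.∣_∣ (ℤ.+-identityʳ (ℤ.+ a))) (ℤ∣.∣⇒∣ᵤ p∣a-0)

  ≡-mod-setoid : Setoid 0ℓ 0ℓ
  ≡-mod-setoid = record
    { Carrier = ℤ ; _≈_ = λ x y → x ≡ y mod p
    ; isEquivalence = record { refl = ≡⇒≡-mod refl ; sym = ≡-mod-sym ; trans = ≡-mod-trans } }

module ≡-mod-Reasoning (p : ℕ) = Relation.Binary.Reasoning.Setoid (≡-mod-setoid {p})

module _ where
  open FreshmansDream ℤ.+-*-commutativeSemiring using (freshmansDream; _^ᴿ_; _·_)

  private
    ^ᴿ≡^ : ∀ x n → x ^ᴿ n ≡ x ℤ.^ n
    ^ᴿ≡^ x zero    = refl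
    ^ᴿ≡^ x (suc n) = cong (x ℤ.*_) (^ᴿ≡^ x n)

    ·≡* : ∀ n x → n · x ≡ ℤ.+ n ℤ.* x
    ·≡* zero    x = sym (ℤ.*-zeroˡ x)
    ·≡* (suc n) x = begin
      x ℤ.+ n · x              ≡⟨ cong₂ ℤ._+_ (sym (ℤ.*-identityˡ x)) (·≡* n x) ⟩
      1ℤ ℤ.* x ℤ.+ ℤ.+ n ℤ.* x  ≡⟨ ℤ.*-distribʳ-+ x 1ℤ (ℤ.+ n) ⟨
      ℤ.+ (suc n) ℤ.* x        ∎
      where open ≡-Reasoning

  freshmansDream-ℤ : ∀ {p} → Prime p → ∀ x y → (x ℤ.+ y) ℤ.^ p ≡ x ℤ.^ p ℤ.+ y ℤ.^ p mod p
  freshmansDream-ℤ {p} p-prime x y = begin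
    (x ℤ.+ y) ℤ.^ p                               ≡⟨ ^ᴿ≡^ (x ℤ.+ y) p ⟨
    (x ℤ.+ y) ^ᴿ p                                ≡⟨ dream ⟩
    y ^ᴿ p ℤ.+ (p · r ℤ.+ x ^ᴿ p)                 ≡⟨ cong₂ (λ a b → a ℤ.+ (b ℤ.+ _)) (^ᴿ≡^ y p) (·≡* p r) ⟩
    y ℤ.^ p ℤ.+ (ℤ.+ p ℤ.* r ℤ.+ x ^ᴿ p)          ≈⟨ ≡-mod-+ (≡⇒≡-mod {x = y ℤ.^ p} refl) (≡-mod-+ (multiple≡0 r) (≡⇒≡-mod (^ᴿ≡^ x p))) ⟩
    y ℤ.^ p ℤ.+ (0ℤ ℤ.+ x ℤ.^ p)                  ≡⟨ cong (λ z → y ℤ.^ p ℤ.+ z) (ℤ.+-identityˡ _) ⟩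
    y ℤ.^ p ℤ.+ x ℤ.^ p                           ≡⟨ ℤ.+-comm (y ℤ.^ p) _ ⟩
    x ℤ.^ p ℤ.+ y ℤ.^ p                           ∎
    where
    open ≡-mod-Reasoning p
    r = proj₁ (freshmansDream p-prime x y)
    dream = proj₂ (freshmansDream p-prime x y)

fermatsLittle : ∀ {p} → Prime p → ∀ a → (ℤ.+ a) ℤ.^ p ≡ ℤ.+ a mod p
fermatsLittle {suc n} _       zero    = ≡⇒≡-mod refl
fermatsLittle {p}     p-prime (suc a) = begin
  (ℤ.+ suc a) ℤ.^ p                  ≡⟨ cong (ℤ._^ p) (ℤ.+-comm 1ℤ (ℤ.+ a)) ⟩
  (ℤ.+ a ℤ.+ 1ℤ) ℤ.^ p             ≈⟨ freshmansDream-ℤ p-prime (ℤ.+ a) 1ℤ ⟩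
  (ℤ.+ a) ℤ.^ p ℤ.+ 1ℤ ℤ.^ p         ≈⟨ ≡-mod-+ (fermatsLittle p-prime a) (≡⇒≡-mod (ℤ.^-zeroˡ p)) ⟩
  ℤ.+ a ℤ.+ 1ℤ                     ≡⟨ ℤ.+-comm (ℤ.+ a) 1ℤ ⟩
  ℤ.+ suc a                        ∎
  where open ≡-mod-Reasoning p

prime∣ℤ-* : ∀ {p} → Prime p → ∀ x y → ℤ.+ p ∣ℤ x ℤ.* y → ℤ.+ p ∣ℤ x ⊎ ℤ.+ p ∣ℤ y
prime∣ℤ-* p-prime x y p∣xy =
  Sum.map ℤ∣.∣ᵤ⇒∣ ℤ∣.∣ᵤ⇒∣ (euclidsLemma ℤ.∣ x ∣ ℤ.∣ y ∣ p-prime (subst (_ ∣_) (ℤ.abs-* x y) (ℤ∣.∣⇒∣ᵤ p∣xy)))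

fermatsLittle-unit : ∀ {p} → Prime p → ∀ {a} → ¬ p ∣ a → (ℤ.+ a) ℤ.^ pred p ≡ 1ℤ mod p
fermatsLittle-unit {suc n} p-prime {a} p∤a with fermatsLittle p-prime a
... | divides-difference p∣a^p-a =
  [ (λ p∣a → ⊥-elim (p∤a (ℤ∣.∣⇒∣ᵤ p∣a))) , divides-difference ]′
    (prime∣ℤ-* p-prime (ℤ.+ a) _ (subst (_ ∣ℤ_) (factor (ℤ.+ a) ((ℤ.+ a) ℤ.^ n)) p∣a^p-a))
  where
  factor : ∀ a b → a ℤ.* b ℤ.- a ≡ a ℤ.* (b ℤ.- 1ℤ)
  factor = ℤsolve-∀

-- The Eisenstein integers ℤ[ω], ω² = −1 − ω, with (a , b) standing for a + bω.
ℤ[ω] : Set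
ℤ[ω] = ℤ × ℤ

infixl 6 _⊕_
infixl 7 _⊗_

_⊕_ : ℤ[ω] → ℤ[ω] → ℤ[ω]
(a , b) ⊕ (c , d) = a ℤ.+ c , b ℤ.+ d

_⊗_ : ℤ[ω] → ℤ[ω] → ℤ[ω]
(a , b) ⊗ (c , d) = a ℤ.* c ℤ.- b ℤ.* d , a ℤ.* d ℤ.+ b ℤ.* c ℤ.- b ℤ.* d

ℤ[ω]-commutativeSemiring : CommutativeSemiring 0ℓ 0ℓ
ℤ[ω]-commutativeSemiring = record
  { Carrier = ℤ[ω] ; _≈_ = _≡_ ; _+_ = _⊕_ ; _*_ = _⊗_ ; 0# = 0ℤ , 0ℤ ; 1# = 1ℤ , 0ℤ
  ; isCommutativeSemiring = IsCommutativeSemiringˡ.isCommutativeSemiring record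
    { +-isCommutativeMonoid = isCommutativeMonoid _⊕_ (0ℤ , 0ℤ) ⊕-assoc ⊕-identityˡ ⊕-comm
    ; *-isCommutativeMonoid = isCommutativeMonoid _⊗_ (1ℤ , 0ℤ) ⊗-assoc ⊗-identityˡ ⊗-comm
    ; distribʳ = distribʳ
    ; zeroˡ    = zeroˡ
    }
  }
  where
  isCommutativeMonoid : ∀ _∙_ ε → Associative _≡_ _∙_ → LeftIdentity _≡_ ε _∙_ → Commutative _≡_ _∙_ →
                        IsCommutativeMonoid _≡_ _∙_ ε
  isCommutativeMonoid _∙_ ε assoc identityˡ comm = record
    { isMonoid = record
      { isSemigroup = record { isMagma = record { isEquivalence = isEquivalence ; ∙-cong = cong₂ _∙_ } ; assoc = assoc }
      ; identity    = identityˡ , λ x → trans (comm x ε) (identityˡ x)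
      }
    ; comm = comm
    }
  componentwise : ∀ {a b c d : ℤ} → a ≡ c → b ≡ d → (a , b) ≡ (c , d)
  componentwise = cong₂ _,_
  ⊕-assoc : Associative _≡_ _⊕_
  ⊕-assoc (a , b) (c , d) (e , f) = componentwise (ℤ.+-assoc a c e) (ℤ.+-assoc b d f)
  ⊕-identityˡ : LeftIdentity _≡_ (0ℤ , 0ℤ) _⊕_
  ⊕-identityˡ (a , b) = componentwise (ℤ.+-identityˡ a) (ℤ.+-identityˡ b)
  ⊕-comm : Commutative _≡_ _⊕_
  ⊕-comm (a , b) (c , d) = componentwise (ℤ.+-comm a c) (ℤ.+-comm b d)
  ⊗-assoc : Associative _≡_ _⊗_
  ⊗-assoc (a , b) (c , d) (e , f) = componentwise (assoc₁ a b c d e f) (assoc₂ a b c d e f)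
    where
    assoc₁ : ∀ a b c d e f → (a ℤ.* c ℤ.- b ℤ.* d) ℤ.* e ℤ.- (a ℤ.* d ℤ.+ b ℤ.* c ℤ.- b ℤ.* d) ℤ.* f
                           ≡ a ℤ.* (c ℤ.* e ℤ.- d ℤ.* f) ℤ.- b ℤ.* (c ℤ.* f ℤ.+ d ℤ.* e ℤ.- d ℤ.* f)
    assoc₁ = ℤsolve-∀
    assoc₂ : ∀ a b c d e f →
      (a ℤ.* c ℤ.- b ℤ.* d) ℤ.* f ℤ.+ (a ℤ.* d ℤ.+ b ℤ.* c ℤ.- b ℤ.* d) ℤ.* e ℤ.- (a ℤ.* d ℤ.+ b ℤ.* c ℤ.- b ℤ.* d) ℤ.* f
      ≡ a ℤ.* (c ℤ.* f ℤ.+ d ℤ.* e ℤ.- d ℤ.* f) ℤ.+ b ℤ.* (c ℤ.* e ℤ.- d ℤ.* f) ℤ.- b ℤ.* (c ℤ.* f ℤ.+ d ℤ.* e ℤ.- d ℤ.* f)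
    assoc₂ = ℤsolve-∀
  ⊗-identityˡ : LeftIdentity _≡_ (1ℤ , 0ℤ) _⊗_
  ⊗-identityˡ (a , b) = componentwise (identity₁ a b) (identity₂ a b)
    where
    identity₁ : ∀ a b → 1ℤ ℤ.* a ℤ.- 0ℤ ℤ.* b ≡ a
    identity₁ = ℤsolve-∀
    identity₂ : ∀ a b → 1ℤ ℤ.* b ℤ.+ 0ℤ ℤ.* a ℤ.- 0ℤ ℤ.* b ≡ b
    identity₂ = ℤsolve-∀
  ⊗-comm : Commutative _≡_ _⊗_
  ⊗-comm (a , b) (c , d) = componentwise (comm₁ a b c d) (comm₂ a b c d)
    where
    comm₁ : ∀ a b c d → a ℤ.* c ℤ.- b ℤ.* d ≡ c ℤ.* a ℤ.- d ℤ.* b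
    comm₁ = ℤsolve-∀
    comm₂ : ∀ a b c d → a ℤ.* d ℤ.+ b ℤ.* c ℤ.- b ℤ.* d ≡ c ℤ.* b ℤ.+ d ℤ.* a ℤ.- d ℤ.* b
    comm₂ = ℤsolve-∀
  distribʳ : _DistributesOverʳ_ _≡_ _⊗_ _⊕_
  distribʳ (a , b) (c , d) (e , f) = componentwise (distrib₁ a b c d e f) (distrib₂ a b c d e f)
    where
    distrib₁ : ∀ a b c d e f → (c ℤ.+ e) ℤ.* a ℤ.- (d ℤ.+ f) ℤ.* b ≡ (c ℤ.* a ℤ.- d ℤ.* b) ℤ.+ (e ℤ.* a ℤ.- f ℤ.* b)
    distrib₁ = ℤsolve-∀
    distrib₂ : ∀ a b c d e f → (c ℤ.+ e) ℤ.* b ℤ.+ (d ℤ.+ f) ℤ.* a ℤ.- (d ℤ.+ f) ℤ.* b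
                             ≡ (c ℤ.* b ℤ.+ d ℤ.* a ℤ.- d ℤ.* b) ℤ.+ (e ℤ.* b ℤ.+ f ℤ.* a ℤ.- f ℤ.* b)
    distrib₂ = ℤsolve-∀
  zeroˡ : LeftZero _≡_ (0ℤ , 0ℤ) _⊗_
  zeroˡ (a , b) = componentwise (zero₁ a b) (zero₂ a b)
    where
    zero₁ : ∀ a b → 0ℤ ℤ.* a ℤ.- 0ℤ ℤ.* b ≡ 0ℤ
    zero₁ = ℤsolve-∀
    zero₂ : ∀ a b → 0ℤ ℤ.* b ℤ.+ 0ℤ ℤ.* a ℤ.- 0ℤ ℤ.* b ≡ 0ℤ
    zero₂ = ℤsolve-∀

module _ where
  open FreshmansDream ℤ[ω]-commutativeSemiring using (freshmansDream)
    renaming (_^ᴿ_ to _^ω_; _·_ to _·ω_)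
  open import Algebra.Properties.Semiring.Exp (CommutativeSemiring.semiring ℤ[ω]-commutativeSemiring)
    using (^-homo-*; ^-assocʳ)
  open import Algebra.Properties.CommutativeSemiring.Exp ℤ[ω]-commutativeSemiring using (^-distrib-*)

  private
    ω : ℤ[ω]
    ω = 0ℤ , 1ℤ

    -1ℤ : ℤ
    -1ℤ = -[1+ 0 ]

    proj₁-·ω : ∀ n x → proj₁ (n ·ω x) ≡ ℤ.+ n ℤ.* proj₁ x
    proj₁-·ω zero    x = sym (ℤ.*-zeroˡ (proj₁ x))
    proj₁-·ω (suc n) x = trans (cong (λ a → proj₁ x ℤ.+ a) (proj₁-·ω n x)) (sym (ℤ.suc-* (ℤ.+ n) (proj₁ x)))

    embed-^ : ∀ a n → (a , 0ℤ) ^ω n ≡ (a ℤ.^ n , 0ℤ)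
    embed-^ a zero    = refl
    embed-^ a (suc n) = trans (cong ((a , 0ℤ) ⊗_) (embed-^ a n)) (cong₂ _,_ (product₁ a (a ℤ.^ n)) (product₂ a (a ℤ.^ n)))
      where
      product₁ : ∀ a b → a ℤ.* b ℤ.- 0ℤ ℤ.* 0ℤ ≡ a ℤ.* b
      product₁ = ℤsolve-∀
      product₂ : ∀ a b → a ℤ.* 0ℤ ℤ.+ 0ℤ ℤ.* b ℤ.- 0ℤ ℤ.* 0ℤ ≡ 0ℤ
      product₂ = ℤsolve-∀

    ω^[3m+2] : ∀ m → ω ^ω (3 * m + 2) ≡ (-1ℤ , -1ℤ)
    ω^[3m+2] zero    = refl
    ω^[3m+2] (suc m) = begin
      ω ^ω (3 * suc m + 2)          ≡⟨ cong (ω ^ω_) (shift m) ⟩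
      ω ^ω (3 + (3 * m + 2))        ≡⟨ ^-homo-* ω 3 (3 * m + 2) ⟩
      ω ^ω 3 ⊗ ω ^ω (3 * m + 2)     ≡⟨ cong (ω ^ω 3 ⊗_) (ω^[3m+2] m) ⟩
      (-1ℤ , -1ℤ)                   ∎
      where
      open ≡-Reasoning
      shift : ∀ m → 3 * suc m + 2 ≡ 3 + (3 * m + 2)
      shift = solve-∀

    [1+2ω]^p-constant : ∀ g → proj₁ ((1ℤ , ℤ.+ 2) ^ω (6 * g + 5)) ≡ -[1+ 2 ] ℤ.^ (3 * g + 2)
    [1+2ω]^p-constant g = begin
      proj₁ (z ^ω p)                             ≡⟨ cong (proj₁ ∘ (z ^ω_)) (p≡1+2h g) ⟩
      proj₁ (z ⊗ z ^ω (2 * h))                   ≡⟨ cong (proj₁ ∘ (z ⊗_)) (^-assocʳ z 2 h) ⟨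
      proj₁ (z ⊗ (z ^ω 2) ^ω h)                  ≡⟨ cong (proj₁ ∘ (z ⊗_)) (embed-^ -[1+ 2 ] h) ⟩
      proj₁ (z ⊗ (-[1+ 2 ] ℤ.^ h , 0ℤ))          ≡⟨ constant (-[1+ 2 ] ℤ.^ h) ⟩
      -[1+ 2 ] ℤ.^ h                             ∎
      where
      open ≡-Reasoning
      z = (1ℤ , ℤ.+ 2)
      p = 6 * g + 5
      h = 3 * g + 2
      p≡1+2h : ∀ g → 6 * g + 5 ≡ suc (2 * (3 * g + 2))
      p≡1+2h = solve-∀
      constant : ∀ c → 1ℤ ℤ.* c ℤ.- ℤ.+ 2 ℤ.* 0ℤ ≡ c
      constant = ℤsolve-∀

    [2ω]^p-constant : ∀ g → proj₁ ((0ℤ , ℤ.+ 2) ^ω (6 * g + 5)) ≡ ℤ.- ((ℤ.+ 2) ℤ.^ (6 * g + 5))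
    [2ω]^p-constant g = begin
      proj₁ ((0ℤ , ℤ.+ 2) ^ω p)                               ≡⟨ cong proj₁ (^-distrib-* (ℤ.+ 2 , 0ℤ) ω p) ⟩
      proj₁ ((ℤ.+ 2 , 0ℤ) ^ω p ⊗ ω ^ω p)           ≡⟨ cong₂ (λ a b → proj₁ (a ⊗ b)) (embed-^ (ℤ.+ 2) p) ω^p≡ω² ⟩
      proj₁ (((ℤ.+ 2) ℤ.^ p , 0ℤ) ⊗ (-1ℤ , -1ℤ))     ≡⟨ constant ((ℤ.+ 2) ℤ.^ p) ⟩
      ℤ.- ((ℤ.+ 2) ℤ.^ p)                            ∎
      where
      open ≡-Reasoning
      p = 6 * g + 5
      p≡3m+2 : ∀ g → 6 * g + 5 ≡ 3 * (2 * g + 1) + 2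
      p≡3m+2 = solve-∀
      ω^p≡ω² : ω ^ω p ≡ (-1ℤ , -1ℤ)
      ω^p≡ω² = trans (cong (ω ^ω_) (p≡3m+2 g)) (ω^[3m+2] (2 * g + 1))
      constant : ∀ c → c ℤ.* -1ℤ ℤ.- 0ℤ ℤ.* -1ℤ ≡ ℤ.- c
      constant = ℤsolve-∀

  -- Expanding (1 + 2ω)^p, where (1 + 2ω)² = −3, by the freshman's dream in ℤ[ω]: since
  -- p ≡ 2 (mod 3) we have ω^p = ω² = −1 − ω, and comparing constant terms gives (−3)^h ≡ 1 − 2^p ≡ −1.
  -3-nonresidue : ∀ g → Prime (6 * g + 5) → -[1+ 2 ] ℤ.^ (3 * g + 2) ≡ -1ℤ mod (6 * g + 5)
  -3-nonresidue g p-prime = begin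
    -[1+ 2 ] ℤ.^ h                                            ≡⟨ constant-z^p ⟨
    proj₁ (z ^ω p)                                            ≡⟨ cong proj₁ dream ⟩
    proj₁ (y ^ω p) ℤ.+ (proj₁ (p ·ω r) ℤ.+ proj₁ (x ^ω p))    ≡⟨ cong₂ (λ a b → a ℤ.+ (b ℤ.+ proj₁ (x ^ω p))) constant-y^p (proj₁-·ω p r) ⟩
    1ℤ ℤ.+ (ℤ.+ p ℤ.* proj₁ r ℤ.+ proj₁ (x ^ω p))             ≡⟨ cong (λ a → 1ℤ ℤ.+ (ℤ.+ p ℤ.* proj₁ r ℤ.+ a)) constant-x^p ⟩
    1ℤ ℤ.+ (ℤ.+ p ℤ.* proj₁ r ℤ.+ ℤ.- ((ℤ.+ 2) ℤ.^ p))         ≈⟨ ≡-mod-+ (≡⇒≡-mod {x = 1ℤ} refl) (≡-mod-+ (multiple≡0 (proj₁ r)) (≡-mod-neg (fermatsLittle p-prime 2))) ⟩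
    1ℤ ℤ.+ (0ℤ ℤ.+ ℤ.- ℤ.+ 2)                                 ≡⟨⟩
    -1ℤ                                                       ∎
    where
    open ≡-mod-Reasoning (6 * g + 5)
    p = 6 * g + 5
    h = 3 * g + 2
    x y z : ℤ[ω]
    x = 0ℤ , ℤ.+ 2
    y = 1ℤ , 0ℤ
    z = 1ℤ , ℤ.+ 2
    r = proj₁ (freshmansDream p-prime x y)
    dream = proj₂ (freshmansDream p-prime x y)
    constant-z^p = [1+2ω]^p-constant g
    constant-x^p = [2ω]^p-constant g
    constant-y^p : proj₁ (y ^ω p) ≡ 1ℤ
    constant-y^p = trans (cong proj₁ (embed-^ 1ℤ p)) (ℤ.^-zeroˡ p)

pos-^ : ∀ a n → ℤ.+ (a ^ n) ≡ (ℤ.+ a) ℤ.^ n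
pos-^ a zero    = refl
pos-^ a (suc n) = trans (ℤ.pos-* a (a ^ n)) (cong (ℤ.+ a ℤ.*_) (pos-^ a n))

Odd : ℕ → Set
Odd u = u % 2 ≡ 1

twoAdic : ∀ n → 0 < n → ∃[ s ] ∃[ u ] Odd u × n ≡ 2 ^ s * u
twoAdic = <-rec (λ n → 0 < n → ∃[ s ] ∃[ u ] Odd u × n ≡ 2 ^ s * u) step
  where
  step : ∀ n → (∀ {m} → m < n → 0 < m → ∃[ s ] ∃[ u ] Odd u × m ≡ 2 ^ s * u) →
         0 < n → ∃[ s ] ∃[ u ] Odd u × n ≡ 2 ^ s * u
  step n rec 0<n with n % 2 in n%2≡ | m%n<n n 2
  ... | 1 | _ = 0 , n , n%2≡ , sym (+-identityʳ n)
  ... | 0 | _ = double (rec (m/n<m n 2 {{>-nonZero 0<n}} (s≤s (s≤s z≤n))) 0<n/2)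
    where
    n≡[n/2]*2 : n ≡ n / 2 * 2
    n≡[n/2]*2 = trans (m≡m%n+[m/n]*n n 2) (cong (_+ n / 2 * 2) n%2≡)
    0<n/2 : 0 < n / 2
    0<n/2 = n≢0⇒n>0 λ n/2≡0 → <⇒≢ 0<n (sym (trans n≡[n/2]*2 (cong (_* 2) n/2≡0)))
    regroup : ∀ a u → a * u * 2 ≡ 2 * a * u
    regroup = solve-∀
    double : ∃[ s ] ∃[ u ] Odd u × n / 2 ≡ 2 ^ s * u → ∃[ s ] ∃[ u ] Odd u × n ≡ 2 ^ s * u
    double (s , u , odd , n/2≡) = suc s , u , odd , (begin
      n                  ≡⟨ n≡[n/2]*2 ⟩
      n / 2 * 2          ≡⟨ cong (_* 2) n/2≡ ⟩
      2 ^ s * u * 2      ≡⟨ regroup (2 ^ s) u ⟩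
      2 ^ suc s * u      ∎)
      where open ≡-Reasoning
  ... | suc (suc _) | s≤s (s≤s ())

odd⇒1+2k : ∀ u → Odd u → u ≡ suc (2 * (u / 2))
odd⇒1+2k u odd = trans (m≡m%n+[m/n]*n u 2) (trans (cong (_+ u / 2 * 2) odd) (cong suc (*-comm (u / 2) 2)))

-1^odd : ∀ u → Odd u → -[1+ 0 ] ℤ.^ u ≡ -[1+ 0 ]
-1^odd u odd = begin
  -[1+ 0 ] ℤ.^ u                             ≡⟨ cong (-[1+ 0 ] ℤ.^_) (odd⇒1+2k u odd) ⟩
  -[1+ 0 ] ℤ.* -[1+ 0 ] ℤ.^ (2 * (u / 2))    ≡⟨ cong (-[1+ 0 ] ℤ.*_) (ℤ.^-*-assoc -[1+ 0 ] 2 (u / 2)) ⟨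
  -[1+ 0 ] ℤ.* 1ℤ ℤ.^ (u / 2)                ≡⟨ cong (-[1+ 0 ] ℤ.*_) (ℤ.^-zeroˡ (u / 2)) ⟩
  -[1+ 0 ]                                   ∎
  where open ≡-Reasoning

a+1∣a^odd+1 : ∀ a u → Odd u → a + 1 ∣ a ^ u + 1
a+1∣a^odd+1 a u odd = ≡0-mod⇒∣ (begin
  ℤ.+ (a ^ u + 1)                 ≡⟨ ℤ.pos-+ (a ^ u) 1 ⟩
  ℤ.+ (a ^ u) ℤ.+ 1ℤ              ≡⟨ cong (ℤ._+ 1ℤ) (pos-^ a u) ⟩
  (ℤ.+ a) ℤ.^ u ℤ.+ 1ℤ            ≈⟨ ≡-mod-+ (≡-mod-^ u a≡-1) (≡⇒≡-mod {x = 1ℤ} refl) ⟩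
  -[1+ 0 ] ℤ.^ u ℤ.+ 1ℤ           ≡⟨ cong (ℤ._+ 1ℤ) (-1^odd u odd) ⟩
  0ℤ                              ∎)
  where
  open ≡-mod-Reasoning (a + 1)
  a≡-1 : ℤ.+ a ≡ -[1+ 0 ] mod (a + 1)
  a≡-1 = divides-difference (ℤ∣.divides 1ℤ (sym (ℤ.*-identityˡ (ℤ.+ (a + 1)))))

prime⇒1<p : ∀ {p} → Prime p → 1 < p
prime⇒1<p {p} p-prime = nonTrivial⇒n>1 p {{prime⇒nonTrivial p-prime}}

prime∣prime⇒≡ : ∀ {q p} → Prime q → Prime p → q ∣ p → q ≡ p
prime∣prime⇒≡ q-prime p-prime q∣p with prime⇒irreducible p-prime q∣p
... | inj₁ refl = ⊥-elim (<-irrefl refl (prime⇒1<p q-prime))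
... | inj₂ q≡p  = q≡p

prime∣^⇒∣ : ∀ {q} → Prime q → ∀ a m → q ∣ a ^ m → q ∣ a
prime∣^⇒∣ q-prime a zero    q∣1 = ⊥-elim (<-irrefl (sym (∣1⇒≡1 q∣1)) (prime⇒1<p q-prime))
prime∣^⇒∣ q-prime a (suc m) q∣a^m+1 = [ id , prime∣^⇒∣ q-prime a m ]′ (euclidsLemma a (a ^ m) q-prime q∣a^m+1)

primeDivisor : ∀ {n} → 1 < n → ∃[ q ] Prime q × q ∣ n
primeDivisor {suc zero} (s≤s ())
primeDivisor {n@(suc (suc _))} _ with factorise n
... | record { factors = [] ; isFactorisation = () }
... | record { factors = q ∷ qs ; isFactorisation = n≡ ; factorsPrime = q-prime ∷ _ } =
  q , q-prime , divides (product qs) (trans n≡ (*-comm q (product qs)))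

divisor-of-12^m : ∀ m d → d ∣ 12 ^ m → ¬ 3 ∣ d → ∃[ j ] d ≡ 2 ^ j
divisor-of-12^m m = <-rec (λ d → d ∣ 12 ^ m → ¬ 3 ∣ d → ∃[ j ] d ≡ 2 ^ j) step
  where
  prime[3] : Prime 3
  prime[3] = from-yes (prime? 3)
  prime∣12 : ∀ {q} → Prime q → q ∣ 12 → q ≡ 2 ⊎ q ≡ 3
  prime∣12 q-prime q∣12 with euclidsLemma 4 3 q-prime q∣12
  ... | inj₂ q∣3 = inj₂ (prime∣prime⇒≡ q-prime prime[3] q∣3)
  ... | inj₁ q∣4 = inj₁ (prime∣prime⇒≡ q-prime prime[2] ([ id , id ]′ (euclidsLemma 2 2 q-prime q∣4)))
  step : ∀ d → (∀ {d′} → d′ < d → d′ ∣ 12 ^ m → ¬ 3 ∣ d′ → ∃[ j ] d′ ≡ 2 ^ j) →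
         d ∣ 12 ^ m → ¬ 3 ∣ d → ∃[ j ] d ≡ 2 ^ j
  step zero          _   0∣12^m _ = ⊥-elim (≢-nonZero⁻¹ (12 ^ m) {{m^n≢0 12 m}} (0∣⇒≡0 0∣12^m))
  step (suc zero)    _   _      _ = 0 , refl
  step d@(suc (suc _)) rec d∣12^m 3∤d with primeDivisor {d} (s≤s (s≤s z≤n))
  ... | q , q-prime , q∣d with prime∣12 q-prime (prime∣^⇒∣ q-prime 12 m (∣-trans q∣d d∣12^m))
  ...   | inj₂ refl = ⊥-elim (3∤d q∣d)
  ...   | inj₁ refl with q∣d
  ...     | divides d′ d≡d′*2 = Product.map suc (λ {j} d′≡2^j → trans d≡d′*2 (trans (cong (_* 2) d′≡2^j) (*-comm (2 ^ j) 2)))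
                                  (rec d′<d (∣-trans d′∣d d∣12^m) (3∤d ∘ flip ∣-trans d′∣d))
    where
    d′∣d : d′ ∣ d
    d′∣d = divides 2 (trans d≡d′*2 (*-comm d′ 2))
    0<d′ : 0 < d′
    0<d′ = n≢0⇒n>0 λ d′≡0 → 1+n≢0 (trans d≡d′*2 (cong (_* 2) d′≡0))
    d′<d : d′ < d
    d′<d = subst (d′ <_) (sym d≡d′*2) (m<m*n d′ 2 {{>-nonZero 0<d′}} (s≤s (s≤s z≤n)))

-- The order of a modulo q is 2^(j+1); by Fermat it divides q − 1.
2^[1+j]∣q-1 : ∀ {q a} j → Prime q → ¬ q ∣ 2 → ¬ q ∣ a → (ℤ.+ a) ℤ.^ (2 ^ j) ≡ -[1+ 0 ] mod q →
              2 ^ suc j ∣ pred q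
2^[1+j]∣q-1 {q} {a} j q-prime q∤2 q∤a a^2^j≡-1
  with twoAdic (pred q) (m<n⇒0<n∸m (prime⇒1<p q-prime))
... | s , u , odd , q-1≡2^s*u with s ≤? j
... | yes s≤j = ⊥-elim (q∤2 (ℤ∣.∣⇒∣ᵤ (∣x-y (≡-mod-trans (≡-mod-sym a^[2^j*u]≡1) a^[2^j*u]≡-1))))
  where
  a^[2^j*u]≡-1 : (ℤ.+ a) ℤ.^ (2 ^ j * u) ≡ -[1+ 0 ] mod q
  a^[2^j*u]≡-1 = begin
    (ℤ.+ a) ℤ.^ (2 ^ j * u)          ≡⟨ ℤ.^-*-assoc (ℤ.+ a) (2 ^ j) u ⟨
    ((ℤ.+ a) ℤ.^ (2 ^ j)) ℤ.^ u      ≈⟨ ≡-mod-^ u a^2^j≡-1 ⟩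
    -[1+ 0 ] ℤ.^ u                   ≡⟨ -1^odd u odd ⟩
    -[1+ 0 ]                         ∎
    where open ≡-mod-Reasoning q
  2^j*u≡[q-1]*2^[j-s] : 2 ^ j * u ≡ pred q * 2 ^ (j ∸ s)
  2^j*u≡[q-1]*2^[j-s] = begin-≡
    2 ^ j * u                        ≡⟨ cong (λ e → 2 ^ e * u) (m+[n∸m]≡n s≤j) ⟨
    2 ^ (s + (j ∸ s)) * u            ≡⟨ cong (_* u) (^-distribˡ-+-* 2 s (j ∸ s)) ⟩
    2 ^ s * 2 ^ (j ∸ s) * u          ≡⟨ swap (2 ^ s) (2 ^ (j ∸ s)) u ⟩
    2 ^ s * u * 2 ^ (j ∸ s)          ≡⟨ cong (_* 2 ^ (j ∸ s)) q-1≡2^s*u ⟨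
    pred q * 2 ^ (j ∸ s)             ∎-≡
    where
    open ≡-Reasoning renaming (begin_ to begin-≡_; _∎ to _∎-≡)
    swap : ∀ a b c → a * b * c ≡ a * c * b
    swap = solve-∀
  a^[2^j*u]≡1 : (ℤ.+ a) ℤ.^ (2 ^ j * u) ≡ 1ℤ mod q
  a^[2^j*u]≡1 = begin
    (ℤ.+ a) ℤ.^ (2 ^ j * u)                   ≡⟨ cong ((ℤ.+ a) ℤ.^_) 2^j*u≡[q-1]*2^[j-s] ⟩
    (ℤ.+ a) ℤ.^ (pred q * 2 ^ (j ∸ s))        ≡⟨ ℤ.^-*-assoc (ℤ.+ a) (pred q) (2 ^ (j ∸ s)) ⟨
    ((ℤ.+ a) ℤ.^ pred q) ℤ.^ 2 ^ (j ∸ s)      ≈⟨ ≡-mod-^ (2 ^ (j ∸ s)) (fermatsLittle-unit q-prime q∤a) ⟩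
    1ℤ ℤ.^ 2 ^ (j ∸ s)                        ≡⟨ ℤ.^-zeroˡ (2 ^ (j ∸ s)) ⟩
    1ℤ                                        ∎
    where open ≡-mod-Reasoning q
... | no s≰j = ∣-trans (divides (2 ^ (s ∸ suc j)) 2^s≡) (divides u (trans q-1≡2^s*u (*-comm (2 ^ s) u)))
  where
  2^s≡ : 2 ^ s ≡ 2 ^ (s ∸ suc j) * 2 ^ suc j
  2^s≡ = trans (cong (2 ^_) (sym (m∸n+n≡m (≰⇒> s≰j)))) (^-distribˡ-+-* 2 (s ∸ suc j) (suc j))

-- Every prime divisor q of N is at least N, by the previous lemma.
proth : ∀ a j → 2 ^ suc j + 1 ∣ a ^ (2 ^ j) + 1 → Prime (2 ^ suc j + 1)
proth a j N∣a^2^j+1 = irreducible⇒prime {{n>1⇒nonTrivial 1<N}} irreducible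
  where
  N = 2 ^ suc j + 1
  1<N : 1 < N
  1<N = +-monoˡ-< 1 (m^n>0 2 (suc j))
  a∣a^2^j : a ∣ a ^ (2 ^ j)
  a∣a^2^j with 2 ^ j | m^n>0 2 j
  ... | suc k | _ = divides (a ^ k) (*-comm a (a ^ k))
  N≤prime-divisor : ∀ {q} → Prime q → q ∣ N → N ≤ q
  N≤prime-divisor {q} q-prime q∣N = begin
    2 ^ suc j + 1      ≤⟨ +-monoˡ-≤ 1 (∣⇒≤ {{>-nonZero (m<n⇒0<n∸m (prime⇒1<p q-prime))}} order∣q-1) ⟩
    pred q + 1         ≡⟨ +-comm (pred q) 1 ⟩
    suc (pred q)       ≡⟨ suc-pred q {{>-nonZero (<-trans (s≤s z≤n) (prime⇒1<p q-prime))}} ⟩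
    q                  ∎
    where
    open ≤-Reasoning
    q∣a^2^j+1 = ∣-trans q∣N N∣a^2^j+1
    q∤1 : ¬ q ∣ 1
    q∤1 q∣1 = <-irrefl (sym (∣1⇒≡1 q∣1)) (prime⇒1<p q-prime)
    q∤2 : ¬ q ∣ 2
    q∤2 q∣2 = q∤1 (∣m+n∣m⇒∣n q∣N (∣-trans q∣2 (divides (2 ^ j) (*-comm 2 (2 ^ j)))))
    q∤a : ¬ q ∣ a
    q∤a q∣a = q∤1 (∣m+n∣m⇒∣n q∣a^2^j+1 (∣-trans q∣a a∣a^2^j))
    a^2^j≡-1 : (ℤ.+ a) ℤ.^ (2 ^ j) ≡ -[1+ 0 ] mod q
    a^2^j≡-1 = divides-difference (subst (ℤ.+ q ∣ℤ_) (trans (ℤ.pos-+ (a ^ 2 ^ j) 1) (cong (ℤ._+ 1ℤ) (pos-^ a (2 ^ j))))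
                                           (ℤ∣.∣ᵤ⇒∣ q∣a^2^j+1))
    order∣q-1 = 2^[1+j]∣q-1 j q-prime q∤2 q∤a a^2^j≡-1
  irreducible : ∀ {d} → d ∣ N → d ≡ 1 ⊎ d ≡ N
  irreducible {zero}          0∣N = ⊥-elim (1+n≢0 (trans (sym (+-comm (2 ^ suc j) 1)) (0∣⇒≡0 0∣N)))
  irreducible {suc zero}      _   = inj₁ refl
  irreducible {d@(suc (suc _))} d∣N with primeDivisor {d} (s≤s (s≤s z≤n))
  ... | q , q-prime , q∣d = inj₂ (≤-antisym (∣⇒≤ {{>-nonZero (<-trans (s≤s z≤n) 1<N)}} d∣N) (≤-trans (N≤prime-divisor q-prime (∣-trans q∣d d∣N)) (∣⇒≤ q∣d)))

fermatExponent : ∀ m → 0 < m → Prime (2 ^ m + 1) → ∃[ k ] m ≡ 2 ^ k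
fermatExponent m 0<m p-prime with twoAdic m 0<m
... | s , 1 , _ , m≡2^s*1 = s , trans m≡2^s*1 (*-identityʳ (2 ^ s))
... | s , zero , () , _
... | s , u@(suc (suc k)) , odd , m≡2^s*u = ⊥-elim ([ A+1≢1 , A+1≢2^m+1 ]′ (prime⇒irreducible p-prime A+1∣2^m+1))
  where
  A = 2 ^ 2 ^ s
  1<A : 1 < A
  1<A = ^-monoʳ-< 2 (s≤s (s≤s z≤n)) (m^n>0 2 s)
  A^u≡2^m : A ^ u ≡ 2 ^ m
  A^u≡2^m = trans (^-*-assoc 2 (2 ^ s) u) (cong (2 ^_) (sym m≡2^s*u))
  A+1∣2^m+1 : A + 1 ∣ 2 ^ m + 1
  A+1∣2^m+1 = subst (λ x → A + 1 ∣ x + 1) A^u≡2^m (a+1∣a^odd+1 A u odd)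
  A+1≢1 : A + 1 ≢ 1
  A+1≢1 A+1≡1 = <⇒≢ (<-trans (s≤s z≤n) 1<A) (sym (+-cancelʳ-≡ 1 A 0 A+1≡1))
  A+1≢2^m+1 : A + 1 ≢ 2 ^ m + 1
  A+1≢2^m+1 eq = <⇒≢ A<A^u (trans (+-cancelʳ-≡ 1 A (2 ^ m) eq) (sym A^u≡2^m))
    where
    A<A^u : A < A ^ u
    A<A^u = m<m*n A (A ^ suc k) {{A≢0}} (<-≤-trans 1<A (m≤m*n A (A ^ k) {{m^n≢0 A k {{A≢0}}}}))
      where A≢0 = >-nonZero (<-trans (s≤s z≤n) 1<A)

Criterion : ℕ → Set
Criterion g = 3 * g + 2 ∣ X g × 6 * g + 5 ∣ X g + 1

3∤3g+2 : ∀ g → ¬ 3 ∣ 3 * g + 2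
3∤3g+2 g 3∣3g+2 with ∣⇒≤ (∣m+n∣m⇒∣n 3∣3g+2 (divides g (*-comm 3 g)))
... | s≤s (s≤s ())

criterion⇒fermat : ∀ g → Criterion g → IsFermatPrime (6 * g + 5)
criterion⇒fermat g (h∣12^h , p∣12^h+1) with divisor-of-12^m (3 * g + 2) (3 * g + 2) h∣12^h (3∤3g+2 g)
... | j , h≡2^j = subst Prime (sym p≡N) N-prime , Product.map id (trans p≡N ∘ cong (λ e → 2 ^ e + 1)) fermat-form
  where
  p≡N : 6 * g + 5 ≡ 2 ^ suc j + 1
  p≡N = trans (p≡2h+1 g) (cong (λ h → 2 * h + 1) h≡2^j)
    where
    p≡2h+1 : ∀ g → 6 * g + 5 ≡ 2 * (3 * g + 2) + 1
    p≡2h+1 = solve-∀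
  N-prime : Prime (2 ^ suc j + 1)
  N-prime = proth 12 j (subst₂ (λ N h → N ∣ 12 ^ h + 1) p≡N h≡2^j p∣12^h+1)
  fermat-form : ∃[ k ] suc j ≡ 2 ^ k
  fermat-form = fermatExponent (suc j) (s≤s z≤n) N-prime

^-distribʳ-* : ∀ m n k → (m * n) ^ k ≡ m ^ k * n ^ k
^-distribʳ-* m n zero    = refl
^-distribʳ-* m n (suc k) = trans (cong (m * n *_) (^-distribʳ-* m n k)) (interchange m n (m ^ k) (n ^ k))
  where
  interchange : ∀ a b c d → a * b * (c * d) ≡ a * c * (b * d)
  interchange = solve-∀

fermat⇒criterion : ∀ g → IsFermatPrime (6 * g + 5) → Criterion g
fermat⇒criterion g (p-prime , k , p≡2^2^k+1) = h∣12^h , p∣12^h+1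
  where
  p = 6 * g + 5
  h = 3 * g + 2
  e = pred (2 ^ k)
  2^k≡1+e : 2 ^ k ≡ suc e
  2^k≡1+e = sym (suc-pred (2 ^ k) {{m^n≢0 2 k}})
  h≡2^e : h ≡ 2 ^ e
  h≡2^e = *-cancelˡ-≡ h (2 ^ e) 2 (+-cancelʳ-≡ 1 (2 * h) (2 * 2 ^ e) (begin
    2 * h + 1          ≡⟨ p≡2h+1 g ⟨
    p                  ≡⟨ p≡2^2^k+1 ⟩
    2 ^ 2 ^ k + 1      ≡⟨ cong (λ x → 2 ^ x + 1) 2^k≡1+e ⟩
    2 * 2 ^ e + 1      ∎))
    where
    open ≡-Reasoning
    p≡2h+1 : ∀ g → 6 * g + 5 ≡ 2 * (3 * g + 2) + 1
    p≡2h+1 = solve-∀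
  h∣12^h : h ∣ 12 ^ h
  h∣12^h = subst (_∣ 12 ^ h) (sym h≡2^e) (∣-trans 2^e∣2^h 2^h∣12^h)
    where
    2^e∣2^h : 2 ^ e ∣ 2 ^ h
    2^e∣2^h = divides (2 ^ (h ∸ e)) (trans (cong (2 ^_) (sym (m∸n+n≡m e≤h))) (^-distribˡ-+-* 2 (h ∸ e) e))
      where e≤h = subst (e ≤_) (sym h≡2^e) (<⇒≤ (n<2^n e))
    2^h∣12^h : 2 ^ h ∣ 12 ^ h
    2^h∣12^h = divides (6 ^ h) (^-distribʳ-* 6 2 h)
  p∤2 : ¬ p ∣ 2
  p∤2 p∣2 with ≤-trans (m≤n+m 5 (6 * g)) (∣⇒≤ p∣2)
  ... | s≤s (s≤s ())
  4^h≡2^[p-1] : ℤ.+ (4 ^ h) ≡ (ℤ.+ 2) ℤ.^ pred p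
  4^h≡2^[p-1] = begin
    ℤ.+ (4 ^ h)                  ≡⟨ pos-^ 4 h ⟩
    (ℤ.+ 4) ℤ.^ h                ≡⟨ ℤ.^-*-assoc (ℤ.+ 2) 2 h ⟩
    (ℤ.+ 2) ℤ.^ (2 * h)          ≡⟨ cong ((ℤ.+ 2) ℤ.^_) (trans (cong pred (+-suc (6 * g) 4)) (p-1≡2h g)) ⟨
    (ℤ.+ 2) ℤ.^ pred p           ∎
    where
    open ≡-Reasoning
    p-1≡2h : ∀ g → 6 * g + 4 ≡ 2 * (3 * g + 2)
    p-1≡2h = solve-∀
  3^h≡[-3]^h : ℤ.+ (3 ^ h) ≡ -[1+ 2 ] ℤ.^ h
  3^h≡[-3]^h = begin
    ℤ.+ (3 ^ h)                       ≡⟨ pos-^ 3 h ⟩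
    (ℤ.+ 3) ℤ.^ h                     ≡⟨ cong ((ℤ.+ 3) ℤ.^_) h≡2*m ⟩
    (ℤ.+ 3) ℤ.^ (2 * m)               ≡⟨ ℤ.^-*-assoc (ℤ.+ 3) 2 m ⟨
    (-[1+ 2 ] ℤ.^ 2) ℤ.^ m            ≡⟨ ℤ.^-*-assoc -[1+ 2 ] 2 m ⟩
    -[1+ 2 ] ℤ.^ (2 * m)              ≡⟨ cong (-[1+ 2 ] ℤ.^_) h≡2*m ⟨
    -[1+ 2 ] ℤ.^ h                    ∎
    where
    open ≡-Reasoning
    m = 2 ^ pred e
    e≢0 : e ≢ 0
    e≢0 e≡0 = 1+n≢0 (suc-injective (trans (+-comm 2 (3 * g)) (trans h≡2^e (cong (2 ^_) e≡0))))
    h≡2*m : h ≡ 2 * m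
    h≡2*m = trans h≡2^e (cong (2 ^_) (sym (suc-pred e {{≢-nonZero e≢0}})))
  -- 12^h = 2^(p−1) · 3^h, where 2^(p−1) ≡ 1 by Fermat and 3^h = (−3)^h ≡ −1 since h is even.
  p∣12^h+1 : p ∣ 12 ^ h + 1
  p∣12^h+1 = ≡0-mod⇒∣ (begin
    ℤ.+ (12 ^ h + 1)                                  ≡⟨ cong (λ x → ℤ.+ (x + 1)) (^-distribʳ-* 4 3 h) ⟩
    ℤ.+ (4 ^ h * 3 ^ h + 1)                           ≡⟨ ℤ.pos-+ (4 ^ h * 3 ^ h) 1 ⟩
    ℤ.+ (4 ^ h * 3 ^ h) ℤ.+ 1ℤ                        ≡⟨ cong (ℤ._+ 1ℤ) (ℤ.pos-* (4 ^ h) (3 ^ h)) ⟩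
    ℤ.+ (4 ^ h) ℤ.* ℤ.+ (3 ^ h) ℤ.+ 1ℤ                ≡⟨ cong₂ (λ x y → x ℤ.* y ℤ.+ 1ℤ) 4^h≡2^[p-1] 3^h≡[-3]^h ⟩
    (ℤ.+ 2) ℤ.^ pred p ℤ.* -[1+ 2 ] ℤ.^ h ℤ.+ 1ℤ      ≈⟨ ≡-mod-+ (≡-mod-* (fermatsLittle-unit p-prime p∤2) (-3-nonresidue g p-prime)) (≡⇒≡-mod {x = 1ℤ} refl) ⟩
    1ℤ ℤ.* -[1+ 0 ] ℤ.+ 1ℤ                            ≡⟨⟩
    0ℤ                                                ∎)
    where
    open ≡-mod-Reasoning p

criterion⇔fermat : ∀ g → Criterion g ⇔ IsFermatPrime (6 * g + 5)
criterion⇔fermat g = mk⇔ (criterion⇒fermat g) (fermat⇒criterion g)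

criterion? : ∀ g → Dec (Criterion g)
criterion? g = (3 * g + 2 ∣? X g) ×-dec (6 * g + 5 ∣? X g + 1)

module _ {n g v a b c d e} (sol : Solves n g v a b c d e) where
  X≡a*[3g+2] : X g ≡ a * (3 * g + 2)
  X≡a*[3g+2] = begin
    X g                   ≡⟨ c≡X sol ⟨
    c                     ≡⟨ c≡3d+2a sol ⟩
    3 * d + 2 * a         ≡⟨ cong (λ d → 3 * d + 2 * a) (d≡ag sol) ⟩
    3 * (a * g) + 2 * a   ≡⟨ factor a g ⟩
    a * (3 * g + 2)       ∎
    where
    open ≡-Reasoning
    factor : ∀ a g → 3 * (a * g) + 2 * a ≡ a * (3 * g + 2)
    factor = solve-∀

  X+1≡b*[6g+5] : X g + 1 ≡ b * (6 * g + 5)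
  X+1≡b*[6g+5] = begin
    X g + 1               ≡⟨ cong (_+ 1) (c≡X sol) ⟨
    c + 1                 ≡⟨ c+1≡6e+5b sol ⟩
    6 * e + 5 * b         ≡⟨ cong (λ e → 6 * e + 5 * b) (e≡bg sol) ⟩
    6 * (b * g) + 5 * b   ≡⟨ factor b g ⟩
    b * (6 * g + 5)       ∎
    where
    open ≡-Reasoning
    factor : ∀ b g → 6 * (b * g) + 5 * b ≡ b * (6 * g + 5)
    factor = solve-∀

  Solves⇒criterion : Criterion g
  Solves⇒criterion = divides a X≡a*[3g+2] , divides b X+1≡b*[6g+5]

  Solves⇒g≤n : g ≤ n
  Solves⇒g≤n = subst (g ≤_) (sym (n≡g+v sol)) (m≤m+n g v)

X+1<tt : ∀ {n g} → g ≤ n → X g + 1 < tt n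
X+1<tt {n} {g} g≤n = begin-strict
  X g + 1              <⟨ +-monoʳ-< (X g) (s≤s (s≤s z≤n)) ⟩
  X g + 11             ≤⟨ +-monoʳ-≤ (X g) (*-monoʳ-≤ 11 (m^n>0 12 (3 * g + 2))) ⟩
  X g + 11 * X g       ≡⟨⟩
  12 * X g             ≤⟨ ^-monoʳ-≤ 12 (≤-trans (≤-reflexive (shift g)) (+-monoˡ-≤ 3 (*-monoʳ-≤ 3 g≤n))) ⟩
  tt n                 ∎
  where
  open ≤-Reasoning
  shift : ∀ g → suc (3 * g + 2) ≡ 3 * g + 3
  shift = solve-∀

-- A criterion witness pins down the unique zero of S with first coordinate g.
zerosAt-criterion : ∀ {n g} → g ≤ n → Criterion g → zerosAt n (tt n) g ≡ 1
zerosAt-criterion {n} {g} g≤n (divides a₀ X≡a₀*h , divides b₀ X+1≡b₀*p) =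
  zerosAt-unique canonical unique v₀<t (<t a₀≤X+1) (<t b₀≤X+1) (<t (m≤m+n (X g) 1)) (<t a₀g≤X+1) (<t b₀g≤X+1)
  where
  t = tt n
  h = 3 * g + 2
  p = 6 * g + 5
  instance
    h≢0 : NonZero h
    h≢0 = >-nonZero (≤-trans (s≤s z≤n) (m≤n+m 2 (3 * g)))
    p≢0 : NonZero p
    p≢0 = >-nonZero (≤-trans (s≤s z≤n) (m≤n+m 5 (6 * g)))
  canonical : Solves n g (n ∸ g) a₀ b₀ (X g) (a₀ * g) (b₀ * g)
  canonical = record
    { c≡X = refl ; d≡ag = refl ; e≡bg = refl ; n≡g+v = sym (m+[n∸m]≡n g≤n)
    ; c≡3d+2a = trans X≡a₀*h (expand₁ a₀ g) ; c+1≡6e+5b = trans X+1≡b₀*p (expand₂ b₀ g) }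
    where
    expand₁ : ∀ a g → a * (3 * g + 2) ≡ 3 * (a * g) + 2 * a
    expand₁ = solve-∀
    expand₂ : ∀ b g → b * (6 * g + 5) ≡ 6 * (b * g) + 5 * b
    expand₂ = solve-∀
  unique : ∀ {v a b c d e} → Solves n g v a b c d e →
           v ≡ n ∸ g × a ≡ a₀ × b ≡ b₀ × c ≡ X g × d ≡ a₀ * g × e ≡ b₀ * g
  unique {v} {a} {b} sol = v≡ , a≡a₀ , b≡b₀ , c≡X sol , trans (d≡ag sol) (cong (_* g) a≡a₀) , trans (e≡bg sol) (cong (_* g) b≡b₀)
    where
    v≡ = sym (trans (cong (_∸ g) (n≡g+v sol)) (m+n∸m≡n g v))
    a≡a₀ = *-cancelʳ-≡ a a₀ h (trans (sym (X≡a*[3g+2] sol)) X≡a₀*h)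
    b≡b₀ = *-cancelʳ-≡ b b₀ p (trans (sym (X+1≡b*[6g+5] sol)) X+1≡b₀*p)
  <t : ∀ {x} → x ≤ X g + 1 → x < t
  <t x≤ = ≤-<-trans x≤ (X+1<tt g≤n)
  v₀<t : n ∸ g < t
  v₀<t = ≤-<-trans (m∸n≤m n g) (n<tt n)
  a₀*g≤X : a₀ * g ≤ X g
  a₀*g≤X = ≤-trans (*-monoʳ-≤ a₀ (≤-trans (m≤n*m g 3) (m≤m+n (3 * g) 2))) (≤-reflexive (sym X≡a₀*h))
  a₀≤X+1 : a₀ ≤ X g + 1
  a₀≤X+1 = ≤-trans (m≤m*n a₀ h) (≤-trans (≤-reflexive (sym X≡a₀*h)) (m≤m+n (X g) 1))
  a₀g≤X+1 : a₀ * g ≤ X g + 1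
  a₀g≤X+1 = ≤-trans a₀*g≤X (m≤m+n (X g) 1)
  b₀≤X+1 : b₀ ≤ X g + 1
  b₀≤X+1 = ≤-trans (m≤m*n b₀ p) (≤-reflexive (sym X+1≡b₀*p))
  b₀g≤X+1 : b₀ * g ≤ X g + 1
  b₀g≤X+1 = ≤-trans (*-monoʳ-≤ b₀ (≤-trans (m≤n*m g 6) (m≤m+n (6 * g) 5))) (≤-reflexive (sym X+1≡b₀*p))

zerosAt≡indicator : ∀ {n g} → g ≤ n → zerosAt n (tt n) g ≡ indicator (criterion? g)
zerosAt≡indicator {n} {g} g≤n with criterion? g
... | yes criterion  = zerosAt-criterion g≤n criterion
... | no ¬criterion = zerosAt-none {n} {tt n} {g} (¬criterion ∘ Solves⇒criterion)

zerosAt-beyond : ∀ {n t g} → n < g → zerosAt n t g ≡ 0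
zerosAt-beyond {n} {t} {g} n<g = zerosAt-none {n} {t} {g} (λ sol → <⇒≱ n<g (Solves⇒g≤n sol))

length-filter-upTo : ∀ {P : ℕ → Set} (P? : Decidable P) k →
                     length (filter P? (upTo k)) ≡ sumℕ k (λ i → indicator (P? i))
length-filter-upTo P? zero    = refl
length-filter-upTo P? (suc k) = begin
  length (filter P? (upTo (suc k)))                        ≡⟨ cong (length ∘ filter P?) (upTo-∷ʳ k) ⟨
  length (filter P? (upTo k ∷ʳ k))                         ≡⟨ cong length (filter-++ P? (upTo k) [ k ]) ⟩
  length (filter P? (upTo k) ++ filter P? [ k ])           ≡⟨ length-++ (filter P? (upTo k)) ⟩
  length (filter P? (upTo k)) + length (filter P? [ k ])   ≡⟨ cong₂ _+_ (length-filter-upTo P? k) singleton ⟩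
  sumℕ k (λ i → indicator (P? i)) + indicator (P? k)       ∎
  where
  open ≡-Reasoning
  singleton : length (filter P? [ k ]) ≡ indicator (P? k)
  singleton with P? k
  ... | yes _ = refl
  ... | no  _ = refl

countZeros : ∀ n → sumℕ (tt n) (zerosAt n (tt n)) ≡ fermatCount n
countZeros n = begin
  sumℕ (tt n) (zerosAt n (tt n))
    ≡⟨ cong (λ k → sumℕ k (zerosAt n (tt n))) (m+[n∸m]≡n (n<tt n)) ⟨
  sumℕ (suc n + (tt n ∸ suc n)) (zerosAt n (tt n))
    ≡⟨ sumℕ-++ (suc n) (tt n ∸ suc n) (zerosAt n (tt n)) ⟩
  sumℕ (suc n) (zerosAt n (tt n)) + sumℕ (tt n ∸ suc n) (λ i → zerosAt n (tt n) (suc n + i))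
    ≡⟨ cong₂ _+_ (sumℕ-cong (suc n) (λ g g≤n → zerosAt≡indicator (≤-pred g≤n)))
                 (sumℕ-zero (tt n ∸ suc n) (λ i _ → zerosAt-beyond {t = tt n} (m≤m+n (suc n) i))) ⟩
  sumℕ (suc n) (λ g → indicator (criterion? g)) + 0
    ≡⟨ +-identityʳ _ ⟩
  sumℕ (suc n) (λ g → indicator (criterion? g))
    ≡⟨ length-filter-upTo criterion? (suc n) ⟨
  length (filter criterion? (upTo (suc n)))
    ≡⟨ cong length (filter-≐ criterion? (λ g → isFermatPrime? (6 * g + 5))
                     ((λ {g} → Equivalence.to (criterion⇔fermat g)) , (λ {g} → Equivalence.from (criterion⇔fermat g)))
                     (upTo (suc n))) ⟩
  fermatCount n
    ∎
  where open ≡-Reasoning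

mainTheorem10 : ∀ (n : ℕ) →
    ∃ λ (m : ℕ) → M n (tt n) (ww n) ≡ ℤ.+ m
    × HW m ≡ ww n * (fermatCount n + tt n ^ 7)
mainTheorem10 n = Mℕ , M≡Mℕ , (begin
  HW Mℕ                                            ≡⟨ HW-Mℕ ⟩
  ww n * (tt n ^ 7 + sumℕ (tt n) (zerosAt n (tt n))) ≡⟨ cong (λ k → ww n * (tt n ^ 7 + k)) (countZeros n) ⟩
  ww n * (tt n ^ 7 + fermatCount n)                ≡⟨ cong (ww n *_) (+-comm (tt n ^ 7) (fermatCount n)) ⟩
  ww n * (fermatCount n + tt n ^ 7)                ∎)
  where
  open Expansion n
  open ≡-Reasoning
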